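{- Let $q=2^r$. (a) For all even $n\ge2$ and all $q$, $N_{DC_1^+(n,q)}(\beta)>0$ for all $\beta\in\mathbb{F}_q$. (b) For all even $n\ge4$ and all $q$, or for $n=2$ and all $q\ge4$, $N_{DC_2^+(n,q)}(\beta)>0$ for all $\beta\in\mathbb{F}_q$. For $n=2$ and $q=2$: $N_{DC_2^+(2,2)}(1)=0$ and $N_{DC_2^+(2,2)}(0)=12=|P^+(4,2)|$. (c) For all odd $n\ge3$ and all $q$, $N_{DC_1^-(n,q)}(\beta)>0$ for all $\beta\in\mathbb{F}_q$. For $n=1$ and all $q$, $N_{DC_1^-(1,q)}(\beta)$ equals $1$ if $\beta=0$, equals $2$ if $\beta\ne0$ and $tr(\beta^{ -1})=0$, and equals $0$ if $\beta\neq0$ and $tr(\beta^{ -1})=1$. (d) For all odd $n\ge3$ and all $q$, $N_{DC_2^-(n,q)}(\beta)>0$ for all $\beta\in\mathbb{F}_q$.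
   Context: Let $q=2^r$ and let $\mathbb{F}_q$ be the field with $q$ elements. Let $tr(x)=x+x^2+\cdots+x^{2^{r-1}}$ be the absolute trace to $\mathbb{F}_2$. $Tr$ is the matrix trace. For a set $D$ of square matrices, $N_D(\beta)=|\{w\in D:Tr\,w=\beta\}|$. $O^+(2n,q)$ is the group of $g\in GL(2n,q)$ preserving $\theta^+(x)=\sum_{i=1}^nx_ix_{n+i}$. $P^+=P^+(2n,q)$ is the subgroup of all products $\begin{bmatrix}A&0\\0&{}^tA^{ -1}\end{bmatrix}\begin{bmatrix}1_n&B\\0&1_n\end{bmatrix}$ with $A\in GL(n,q)$ and $B$ an $n\times n$ symmetric matrix with zero diagonal. For $0\le s\le n$, $\sigma_s^+$ is the $2n\times2n$ matrix which, in block form for $2n=s+(n-s)+s+(n-s)$, is $\begin{bmatrix}0&0&1_s&0\\0&1_{n-s}&0&0\\1_s&0&0&0\\0&0&0&1_{n-s}\end{bmatrix}$. The double cosets are: - $DC_1^+(n,q)=P^+\sigma_{n-1}^+P^+$ and $DC_2^+(n,q)=P^+\sigma_{n-2}^+P^+$ for even $n\ge2$; - $DC_1^-(n,q)=P^+\sigma_{n-1}^+P^+$ for odd $n\ge1$; - $DC_2^-(n,q)=P^+\sigma_{n-2}^+P^+$ for odd $n\ge3$. -}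

module Defs where

open import Level using (0ℓ)
open import Data.Nat as ℕ using (ℕ; zero; suc; _<?_; _^_)
open import Data.Fin as Fin using (Fin; splitAt; toℕ)
open import Data.Sum using (_⊎_; inj₁; inj₂)
open import Data.Bool using (Bool; true; false; if_then_else_; _∧_; not)
open import Data.Product using (Σ; ∃; _×_; _,_)
open import Relation.Nullary.Decidable using (⌊_⌋)
open import Relation.Binary.PropositionalEquality using (_≡_; _≢_)
open import Algebra.Structures using (IsCommutativeRing)
open import Function.Bundles using (_↔_)

-- A finite field with q = 2 ^ r elements (equality is propositional equality;
-- any concrete model of F_q can be taken this way).
record FiniteField2 : Set₁ where
  infixl 6 _+_
  infixl 7 _*_
  field
    Carrier : Set
    _+_ _*_ : Carrier → Carrier → Carrier
    -_      : Carrier → Carrier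
    0# 1#   : Carrier
    inv     : Carrier → Carrier
    isCommutativeRing : IsCommutativeRing _≡_ _+_ _*_ -_ 0# 1#
    0≢1     : 0# ≢ 1#
    inv-law : ∀ x → x ≢ 0# → x * inv x ≡ 1#
    r       : ℕ
    enum    : Fin (2 ^ r) ↔ Carrier

module FieldDefs (F : FiniteField2) where
  open FiniteField2 F public

  ∑ : ∀ {n} → (Fin n → Carrier) → Carrier
  ∑ {zero}  f = 0#
  ∑ {suc n} f = f Fin.zero + ∑ (λ i → f (Fin.suc i))

  pow : Carrier → ℕ → Carrier
  pow x zero    = 1#
  pow x (suc m) = x * pow x m

  tr : Carrier → Carrier
  tr x = ∑ {r} (λ i → pow x (2 ^ toℕ i))

  Mat : ℕ → ℕ → Set
  Mat m n = Fin m → Fin n → Carrier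

  _≋_ : ∀ {m n} → Mat m n → Mat m n → Set
  A ≋ B = ∀ i j → A i j ≡ B i j

  _⊗_ : ∀ {m k n} → Mat m k → Mat k n → Mat m n
  (A ⊗ B) i j = ∑ (λ l → A i l * B l j)

  I : ∀ n → Mat n n
  I n i j = if ⌊ i Fin.≟ j ⌋ then 1# else 0#

  O : ∀ m n → Mat m n
  O m n i j = 0#

  transpose : ∀ {m n} → Mat m n → Mat n m
  transpose A i j = A j i

  Tr : ∀ {n} → Mat n n → Carrier
  Tr A = ∑ (λ i → A i i)

  block : ∀ {n} → Mat n n → Mat n n → Mat n n → Mat n n → Mat (n ℕ.+ n) (n ℕ.+ n)
  block {n} A B C D i j with splitAt n i | splitAt n j
  ... | inj₁ a | inj₁ b = A a b
  ... | inj₁ a | inj₂ b = B a b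
  ... | inj₂ a | inj₁ b = C a b
  ... | inj₂ a | inj₂ b = D a b

  IsInverse : ∀ {n} → Mat n n → Mat n n → Set
  IsInverse {n} A A' = ((A ⊗ A') ≋ I n) × ((A' ⊗ A) ≋ I n)

  SymZeroDiag : ∀ {n} → Mat n n → Set
  SymZeroDiag B = (∀ i j → B i j ≡ B j i) × (∀ i → B i i ≡ 0#)

  InP : ∀ n → Mat (n ℕ.+ n) (n ℕ.+ n) → Set
  InP n w = Σ (Mat n n) λ A → Σ (Mat n n) λ A' → Σ (Mat n n) λ B →
    IsInverse A A' × SymZeroDiag B ×
    (w ≋ (block A (O n n) (O n n) (transpose A') ⊗ block (I n) B (O n n) (I n)))

  -- σ_s^+ : block form for 2n = s + (n-s) + s + (n-s)
  σ : ∀ n → ℕ → Mat (n ℕ.+ n) (n ℕ.+ n)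
  σ n s i j with splitAt n i | splitAt n j
  ... | inj₁ a | inj₁ b = if ⌊ a Fin.≟ b ⌋ ∧ not ⌊ toℕ a <? s ⌋ then 1# else 0#
  ... | inj₁ a | inj₂ b = if ⌊ a Fin.≟ b ⌋ ∧ ⌊ toℕ a <? s ⌋ then 1# else 0#
  ... | inj₂ a | inj₁ b = if ⌊ a Fin.≟ b ⌋ ∧ ⌊ toℕ a <? s ⌋ then 1# else 0#
  ... | inj₂ a | inj₂ b = if ⌊ a Fin.≟ b ⌋ ∧ not ⌊ toℕ a <? s ⌋ then 1# else 0#

  InDC : ∀ n → ℕ → Mat (n ℕ.+ n) (n ℕ.+ n) → Set
  InDC n s w = Σ (Mat (n ℕ.+ n) (n ℕ.+ n)) λ p₁ → Σ (Mat (n ℕ.+ n) (n ℕ.+ n)) λ p₂ →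
    InP n p₁ × InP n p₂ × (w ≋ ((p₁ ⊗ σ n s) ⊗ p₂))

  HasCard : ∀ {m} → ℕ → (Mat m m → Set) → Set
  HasCard {m} k P = Σ (Fin k → Mat m m) λ f →
    (∀ i → P (f i)) ×
    (∀ i j → f i ≋ f j → i ≡ j) ×
    (∀ w → P w → ∃ λ i → w ≋ f i)

  N-DC≡ : ∀ n → ℕ → Carrier → ℕ → Set
  N-DC≡ n s β k = HasCard k (λ w → InDC n s w × Tr w ≡ β)

  N-DC>0 : ∀ n → ℕ → Carrier → Set
  N-DC>0 n s β = Σ ℕ λ k → (0 ℕ.< k) × N-DC≡ n s β k

-- For n ≥ 2 and s ≥ 1 take p₂ = diag(A, ᵗA⁻¹)·[[1, B], [0, 1]] with A = 1 + e₀₁ (its own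
-- inverse in characteristic 2) and B = b (e₀₁ + e₁₀): then Tr (σ_s p₂) is b plus a constant,
-- so every β is a trace.  For (n, s) = (2, 0) the trace of σ₀ diag(A, ᵗA⁻¹) is tr A + tr A⁻¹,
-- which for a companion matrix A with det A ∉ {0, 1} takes every value once q ≥ 4; for q = 2
-- an exhaustive computation shows that P⁺(4,2) has 12 elements, is closed under products and
-- consists of matrices of trace 0.  For n = 1 the double coset is {diag(u, u⁻¹)}, so N(β)
-- counts the solutions of u + u⁻¹ = β; for β ≠ 0 dividing by β gives y² + y = β⁻², which is
-- solvable exactly when tr (β⁻¹) = 0 (additive Hilbert 90) and then has two solutions.
-- All sets involved are finite and decidable, so a witness yields a positive count.

module Submission where

open import Level using (0ℓ)
open import Function using (_∘_; id; _↔_; mk↔ₛ′; Inverse)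
open import Function.Properties.Inverse using (↔-trans; ↔-sym)
open import Data.Nat as ℕ using (ℕ; zero; suc; _<_; _<?_; _≤_; _%_; _∸_; _^_; >-nonZero⁻¹; s≤s; z≤n)
open import Data.Nat.Properties using (^-monoʳ-≤; m^n≢0; m≤n⇒m<n∨m≡n; ^-monoʳ-<; n<1+n)
open import Data.Fin as Fin using (Fin; zero; suc; _↑ˡ_; _↑ʳ_; splitAt; inject₁; inject≤; fromℕ; toℕ)
open import Data.Fin.Properties using (any?; 2↔Bool; ↑ˡ-injective; ↑ʳ-injective; splitAt-↑ˡ; splitAt-↑ʳ; splitAt⁻¹-↑ˡ; splitAt⁻¹-↑ʳ; nonZeroIndex; punchInᵢ≢i; suc-injective; all?; ¬∀⟶∃¬; inject≤-injective; toℕ-inject₁; toℕ-fromℕ; toℕ<n)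
open import Data.Product using (Σ; ∃; _×_; _,_; proj₁; proj₂)
open import Data.Sum using (_⊎_; inj₁; inj₂)
open import Data.Maybe using (nothing)
open import Data.Unit using (tt)
open import Data.List.Base as List using (List; []; _∷_; [_]; filter; deduplicate; length; lookup; cartesianProductWith)
open import Data.List.Relation.Unary.All using (All; _∷_)
open import Data.List.Relation.Unary.All.Properties using (all-filter) renaming (deduplicate⁺ to All-deduplicate⁺)
open import Data.List.Relation.Unary.Any as Any using (Any; here)
open import Data.List.Relation.Unary.Any.Properties using (lookup-index)
open import Data.List.Relation.Unary.AllPairs using (_∷_)
open import Data.List.Relation.Unary.Enumerates.Setoid using (IsEnumeration)
open import Data.List.Membership.Propositional using (_∈_)
open import Data.List.Membership.Propositional.Properties using (∈-tabulate⁺)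
import Data.List.Membership.Setoid.Properties as Membership
import Data.List.Relation.Unary.Unique.DecSetoid.Properties as UniqueProperties
open import Data.Vec.Functional as Vector using (Vector; head; tail)
import Data.Vec.Functional.Relation.Binary.Pointwise.Properties as Pointwise
open import Relation.Binary.Bundles using (Setoid; DecSetoid)
open import Relation.Binary.Definitions using (_Respects_; DecidableEquality)
open import Relation.Binary.PropositionalEquality as ≡ using (_≡_; _≢_; refl; sym; trans; cong; cong₂; subst)
open ≡.≡-Reasoning
open import Relation.Nullary using (Dec; yes; no; ¬_; contradiction)
open import Relation.Nullary.Decidable using (map′; _×-dec_; _→-dec_; ⌊_⌋; toWitness)
open import Data.Bool using (Bool; true; false; if_then_else_; _∧_; _xor_; not)
open import Data.Bool.Properties using (xor-∧-commutativeRing)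
open import Relation.Unary using (Pred; Decidable)
open import Algebra.Bundles using (CommutativeRing; CommutativeMonoid)
open import Algebra.Structures using (IsCommutativeRing)
import Algebra.Properties.Ring as RingProperties
import Algebra.Properties.CommutativeMonoid.Sum as CommutativeMonoidSum
open import Tactic.RingSolver.Core.AlmostCommutativeRing using (fromCommutativeRing)
import Tactic.RingSolver.NonReflective as RingSolver

open import Defs

vectors : ∀ {a} {A : Set a} n → List A → List (Vector A n)
vectors zero    xs = [ (λ ()) ]
vectors (suc n) xs = cartesianProductWith Vector._∷_ xs (vectors n xs)

module _ {a ℓ} (S : Setoid a ℓ) where
  open Setoid S using (_≈_) renaming (Carrier to A; refl to ≈-refl)

  vectors-isEnumeration : ∀ {xs} → IsEnumeration S xs →
                          ∀ n → IsEnumeration (Pointwise.setoid S n) (vectors n xs)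
  vectors-isEnumeration xs-enum zero    v = here (λ ())
  vectors-isEnumeration xs-enum (suc n) v =
    Membership.∈-resp-≈ (Pointwise.setoid S (suc n)) head∷tail
      (Membership.∈-cartesianProductWith⁺ S (Pointwise.setoid S n) (Pointwise.setoid S (suc n))
        ∷-cong (xs-enum (head v)) (vectors-isEnumeration xs-enum n (tail v)))
    where
      ∷-cong : ∀ {x y} {u w : Vector A n} → x ≈ y → (∀ i → u i ≈ w i) → ∀ i → (x Vector.∷ u) i ≈ (y Vector.∷ w) i
      ∷-cong x≈y u≈w zero    = x≈y
      ∷-cong x≈y u≈w (suc i) = u≈w i
      head∷tail : ∀ i → (head v Vector.∷ tail v) i ≈ v i
      head∷tail zero    = ≈-refl
      head∷tail (suc i) = ≈-refl

module FiniteDecSetoid {a ℓ} (S : DecSetoid a ℓ) {xs} (xs-enum : IsEnumeration (DecSetoid.setoid S) xs) where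
  open DecSetoid S using (_≈_; _≟_; setoid) renaming (Carrier to A; sym to ≈-sym; trans to ≈-trans)
  open import Data.List.Relation.Unary.Unique.Setoid setoid using (Unique)

  HasSize : ∀ {p} → ℕ → Pred A p → Set _
  HasSize k P = Σ (Fin k → A) λ f →
    (∀ i → P (f i)) × (∀ i j → f i ≈ f j → i ≡ j) × (∀ a → P a → ∃ λ i → a ≈ f i)

  module _ {p} {P : Pred A p} (resp : P Respects _≈_) (P? : Decidable P) where

    ∃? : Dec (∃ P)
    ∃? with Any.any? P? xs
    ... | yes hit = yes (Any.satisfied hit)
    ... | no miss = no λ (a , pa) → miss (Any.map (λ a≈x → resp a≈x pa) (xs-enum a))

    representatives : List A
    representatives = deduplicate _≟_ (filter P? xs)

    size : ℕ
    size = length representatives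

    private
      All-lookup : ∀ {q} {Q : Pred A q} {ys} → All Q ys → ∀ i → Q (lookup ys i)
      All-lookup (qy ∷ _)   zero    = qy
      All-lookup (_  ∷ qys) (suc i) = All-lookup qys i

      Unique-lookup-injective : ∀ {ys} → Unique ys → ∀ i j → lookup ys i ≈ lookup ys j → i ≡ j
      Unique-lookup-injective (_ ∷ _)   zero    zero    _ = refl
      Unique-lookup-injective (y≉ ∷ _)  zero    (suc j) e = contradiction e (All-lookup y≉ j)
      Unique-lookup-injective (y≉ ∷ _)  (suc i) zero    e = contradiction (≈-sym e) (All-lookup y≉ i)
      Unique-lookup-injective (_ ∷ u)   (suc i) (suc j) e = cong suc (Unique-lookup-injective u i j e)

      complete : ∀ a → P a → Any (a ≈_) representatives
      complete a pa = Membership.∈-deduplicate⁺ setoid _≟_ (λ z≈y x≈y → ≈-trans x≈y (≈-sym z≈y))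
                        (Membership.∈-filter⁺ setoid P? resp (xs-enum a) pa)

    hasSize : HasSize size P
    hasSize = lookup representatives
            , All-lookup (All-deduplicate⁺ _≟_ (all-filter P? xs))
            , Unique-lookup-injective (UniqueProperties.deduplicate-! S (filter P? xs))
            , λ a pa → Any.index (complete a pa) , lookup-index (complete a pa)

    size-positive : ∀ {a} → P a → 0 < size
    size-positive {a} pa = >-nonZero⁻¹ size {{nonZeroIndex (Any.index (complete a pa))}}

module FieldFacts (F : FiniteField2) where
  open FieldDefs F public
  open IsCommutativeRing isCommutativeRing public
    using (+-comm; +-assoc; *-comm; *-assoc; distribˡ; distribʳ; +-identityˡ; +-identityʳ;
           *-identityˡ; *-identityʳ; -‿inverseˡ; -‿inverseʳ; zeroˡ; zeroʳ)

  commutativeRing : CommutativeRing 0ℓ 0ℓ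
  commutativeRing = record { isCommutativeRing = isCommutativeRing }

  open RingProperties (CommutativeRing.ring commutativeRing) public
    using (-‿distribˡ-*; -‿involutive; +-inverseʳ-unique)

  open RingSolver (fromCommutativeRing commutativeRing (λ _ → nothing)) public
    using (solve; _⊜_; _⊕_) renaming (_⊗_ to _⊛_)

  q : ℕ
  q = 2 ^ r

  element : Fin q → Carrier
  element = Inverse.to enum

  index : Carrier → Fin q
  index = Inverse.from enum

  element-index : ∀ x → element (index x) ≡ x
  element-index = Inverse.strictlyInverseˡ enum

  element-injective : ∀ {i j} → element i ≡ element j → i ≡ j
  element-injective {i} {j} e =
    trans (sym (Inverse.strictlyInverseʳ enum i)) (trans (cong index e) (Inverse.strictlyInverseʳ enum j))

  infix 4 _≟_
  _≟_ : DecidableEquality Carrier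
  x ≟ y = map′ (λ e → trans (sym (element-index x)) (trans (cong element e) (element-index y)))
               (cong index) (index x Fin.≟ index y)

  elements : List Carrier
  elements = List.tabulate element

  elements-isEnumeration : IsEnumeration (≡.setoid Carrier) elements
  elements-isEnumeration x = subst (_∈ elements) (element-index x) (∈-tabulate⁺ (index x))

  x*y≡0⇒y≡0 : ∀ {x y} → x ≢ 0# → x * y ≡ 0# → y ≡ 0#
  x*y≡0⇒y≡0 {x} {y} x≢0 xy≡0 = begin
    y                 ≡⟨ sym (*-identityˡ y) ⟩
    1# * y            ≡⟨ cong (_* y) (sym (trans (*-comm (inv x) x) (inv-law x x≢0))) ⟩
    (inv x * x) * y   ≡⟨ *-assoc (inv x) x y ⟩
    inv x * (x * y)   ≡⟨ cong (inv x *_) xy≡0 ⟩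
    inv x * 0#        ≡⟨ zeroʳ (inv x) ⟩
    0#                ∎

  *-≢0 : ∀ {x y} → x ≢ 0# → y ≢ 0# → x * y ≢ 0#
  *-≢0 x≢0 y≢0 xy≡0 = y≢0 (x*y≡0⇒y≡0 x≢0 xy≡0)

  *-cancelʳ : ∀ {x y p} → p ≢ 0# → x * p ≡ y * p → x ≡ y
  *-cancelʳ {x} {y} {p} p≢0 e = begin
    x                  ≡⟨ sym (*-identityʳ x) ⟩
    x * 1#             ≡⟨ cong (x *_) (sym (inv-law p p≢0)) ⟩
    x * (p * inv p)    ≡⟨ sym (*-assoc x p (inv p)) ⟩
    (x * p) * inv p    ≡⟨ cong (_* inv p) e ⟩
    (y * p) * inv p    ≡⟨ *-assoc y p (inv p) ⟩
    y * (p * inv p)    ≡⟨ cong (y *_) (inv-law p p≢0) ⟩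
    y * 1#             ≡⟨ *-identityʳ y ⟩
    y                  ∎

  infixl 6 _-_
  _-_ : Carrier → Carrier → Carrier
  x - y = x + - y

  x-y≡0⇒x≡y : ∀ {x y} → x - y ≡ 0# → x ≡ y
  x-y≡0⇒x≡y {x} {y} e =
    trans (sym (-‿involutive x)) (trans (cong -_ (sym (+-inverseʳ-unique x (- y) e))) (-‿involutive y))

  x+y≡x⇒y≡0 : ∀ {x y} → x + y ≡ x → y ≡ 0#
  x+y≡x⇒y≡0 {x} {y} e = begin
    y                ≡⟨ sym (+-identityˡ y) ⟩
    0# + y           ≡⟨ cong (_+ y) (sym (-‿inverseˡ x)) ⟩
    (- x + x) + y    ≡⟨ +-assoc (- x) x y ⟩
    - x + (x + y)    ≡⟨ cong (- x +_) e ⟩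
    - x + x          ≡⟨ -‿inverseˡ x ⟩
    0#               ∎

  ∑-cong : ∀ {n} {f g : Fin n → Carrier} → (∀ i → f i ≡ g i) → ∑ f ≡ ∑ g
  ∑-cong {zero}  e = refl
  ∑-cong {suc n} e = cong₂ _+_ (e zero) (∑-cong (e ∘ suc))

  ∑-distrib-+ : ∀ {n} (f g : Fin n → Carrier) → ∑ (λ i → f i + g i) ≡ ∑ f + ∑ g
  ∑-distrib-+ {zero}  f g = sym (+-identityˡ 0#)
  ∑-distrib-+ {suc n} f g =
    trans (cong (f zero + g zero +_) (∑-distrib-+ (f ∘ suc) (g ∘ suc)))
          (solve 4 (λ a b c d → (a ⊕ b) ⊕ (c ⊕ d) ⊜ ((a ⊕ c) ⊕ (b ⊕ d))) refl _ _ _ _)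

  ∑-zero : ∀ {n} (f : Fin n → Carrier) → (∀ i → f i ≡ 0#) → ∑ f ≡ 0#
  ∑-zero {zero}  f z = refl
  ∑-zero {suc n} f z = trans (cong₂ _+_ (z zero) (∑-zero (f ∘ suc) (z ∘ suc))) (+-identityˡ 0#)

  ∑-single : ∀ {n} (f : Fin n → Carrier) k → (∀ l → l ≢ k → f l ≡ 0#) → ∑ f ≡ f k
  ∑-single {suc n} f zero    z =
    trans (cong (f zero +_) (∑-zero (f ∘ suc) (λ i → z (suc i) λ ()))) (+-identityʳ (f zero))
  ∑-single {suc n} f (suc k) z =
    trans (cong₂ _+_ (z zero λ ()) (∑-single (f ∘ suc) k (λ l l≢k → z (suc l) (l≢k ∘ suc-injective))))
          (+-identityˡ (f (suc k)))

  ∑-++ : ∀ m {n} (f : Fin (m ℕ.+ n) → Carrier) → ∑ f ≡ ∑ (λ i → f (i ↑ˡ n)) + ∑ (λ i → f (m ↑ʳ i))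
  ∑-++ zero    f = sym (+-identityˡ (∑ f))
  ∑-++ (suc m) f = trans (cong (f zero +_) (∑-++ m (f ∘ suc))) (sym (+-assoc _ _ _))

  ∑-init-last : ∀ {n} (f : Fin (suc n) → Carrier) → ∑ f ≡ ∑ (f ∘ inject₁) + f (fromℕ n)
  ∑-init-last {zero}  f = trans (+-identityʳ (f zero)) (sym (+-identityˡ (f zero)))
  ∑-init-last {suc n} f = trans (cong (f zero +_) (∑-init-last (f ∘ suc))) (sym (+-assoc _ _ _))

  pow-+ : ∀ x m n → pow x (m ℕ.+ n) ≡ pow x m * pow x n
  pow-+ x zero    n = sym (*-identityˡ (pow x n))
  pow-+ x (suc m) n = trans (cong (x *_) (pow-+ x m n)) (sym (*-assoc x (pow x m) (pow x n)))

  pow-*-distrib : ∀ x y m → pow (x * y) m ≡ pow x m * pow y m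
  pow-*-distrib x y zero    = sym (*-identityˡ 1#)
  pow-*-distrib x y (suc m) =
    trans (cong (x * y *_) (pow-*-distrib x y m))
          (solve 4 (λ a b c d → (a ⊛ b) ⊛ (c ⊛ d) ⊜ ((a ⊛ c) ⊛ (b ⊛ d))) refl _ _ _ _)

  pow≡0⇒≡0 : ∀ k {x} → pow x k ≡ 0# → x ≡ 0#
  pow≡0⇒≡0 zero    e = contradiction (sym e) 0≢1
  pow≡0⇒≡0 (suc k) {x} e with x ≟ 0#
  ... | yes x≡0 = x≡0
  ... | no  x≢0 = pow≡0⇒≡0 k (x*y≡0⇒y≡0 x≢0 e)

  module Reindexing (M : CommutativeMonoid 0ℓ 0ℓ) where
    open CommutativeMonoid M using (_≈_) renaming (Carrier to X; trans to ≈-trans; reflexive to ≈-reflexive)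
    open CommutativeMonoidSum M using (sum; sum-permute; sum-cong-≗)

    sum-bijection : (g : Carrier ↔ Carrier) (h : Carrier → X) →
                    sum (h ∘ element) ≈ sum (λ i → h (Inverse.to g (element i)))
    sum-bijection g h = ≈-trans (sum-permute (h ∘ element) π)
      (≈-reflexive (sum-cong-≗ λ i → cong h (element-index (Inverse.to g (element i)))))
      where π = ↔-trans enum (↔-trans g (↔-sym enum))

  module Additive = CommutativeMonoidSum (CommutativeRing.+-commutativeMonoid commutativeRing)
  module Multiplicative = CommutativeMonoidSum (CommutativeRing.*-commutativeMonoid commutativeRing)

  ∑≡sum : ∀ {n} (f : Fin n → Carrier) → ∑ f ≡ Additive.sum f
  ∑≡sum {zero}  f = refl
  ∑≡sum {suc n} f = cong (f zero +_) (∑≡sum (f ∘ suc))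

  ∏ : ∀ {n} → (Fin n → Carrier) → Carrier
  ∏ = Multiplicative.sum

  ∏-*-const : ∀ {n} c (f : Fin n → Carrier) → ∏ (λ i → c * f i) ≡ pow c n * ∏ f
  ∏-*-const {zero}  c f = sym (*-identityˡ 1#)
  ∏-*-const {suc n} c f =
    trans (cong (c * f zero *_) (∏-*-const c (f ∘ suc)))
          (solve 4 (λ a b c d → (a ⊛ b) ⊛ (c ⊛ d) ⊜ ((a ⊛ c) ⊛ (b ⊛ d))) refl _ _ _ _)

  ∏-≢0 : ∀ {n} (f : Fin n → Carrier) → (∀ i → f i ≢ 0#) → ∏ f ≢ 0#
  ∏-≢0 {zero}  f nz e = 0≢1 (sym e)
  ∏-≢0 {suc n} f nz = *-≢0 (nz zero) (∏-≢0 (f ∘ suc) (nz ∘ suc))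

  ∏-single : ∀ {n} (f : Fin n → Carrier) k → (∀ l → l ≢ k → f l ≡ 1#) → ∏ f ≡ f k
  ∏-single {suc n} f k one = trans (Multiplicative.sum-remove {i = k} f)
    (trans (cong (f k *_) (trans (Multiplicative.sum-cong-≗ (λ l → one _ (punchInᵢ≢i k l)))
                                 (Multiplicative.sum-replicate-zero n)))
           (*-identityʳ (f k)))

  translation : Carrier → Carrier ↔ Carrier
  translation c = mk↔ₛ′ (_+ c) (_+ - c) (cancel (- c) c (-‿inverseʳ c)) (cancel c (- c) (-‿inverseˡ c))
    where cancel : ∀ u v → v + u ≡ 0# → ∀ x → (x + u) + v ≡ x
          cancel u v vu x = trans (+-assoc x u v) (trans (cong (x +_) (trans (+-comm u v) vu)) (+-identityʳ x))

  dilation : ∀ {c} → c ≢ 0# → Carrier ↔ Carrier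
  dilation {c} c≢0 = mk↔ₛ′ (c *_) (inv c *_) (cancel c (inv c) (inv-law c c≢0))
                                             (cancel (inv c) c (trans (*-comm (inv c) c) (inv-law c c≢0)))
    where cancel : ∀ u v → u * v ≡ 1# → ∀ x → u * (v * x) ≡ x
          cancel u v uv x = trans (sym (*-assoc u v x)) (trans (cong (_* x) uv) (*-identityˡ x))

module Characteristic2 (F : FiniteField2) where
  open FieldFacts F public

  x+x≡2x : ∀ x → x + x ≡ (1# + 1#) * x
  x+x≡2x x = trans (cong₂ _+_ (sym (*-identityˡ x)) (sym (*-identityˡ x))) (sym (distribʳ x 1# 1#))

  private
    ∑-ones : ∀ k → ∑ {2 ^ k} (λ _ → 1#) ≡ pow (1# + 1#) k
    ∑-ones zero    = +-identityʳ 1#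
    ∑-ones (suc k) = begin
      ∑ {2 ^ suc k} (λ _ → 1#)                         ≡⟨ ∑-++ (2 ^ k) (λ _ → 1#) ⟩
      ∑ {2 ^ k} (λ _ → 1#) + ∑ {2 ^ k ℕ.+ 0} (λ _ → 1#) ≡⟨ cong (∑ {2 ^ k} (λ _ → 1#) +_) (trans (∑-++ (2 ^ k) {0} (λ _ → 1#)) (+-identityʳ _)) ⟩
      ∑ {2 ^ k} (λ _ → 1#) + ∑ {2 ^ k} (λ _ → 1#)       ≡⟨ cong₂ _+_ (∑-ones k) (∑-ones k) ⟩
      pow (1# + 1#) k + pow (1# + 1#) k               ≡⟨ x+x≡2x _ ⟩
      pow (1# + 1#) (suc k)                           ∎

  -- Translating by 1 permutes the field, so q · 1 = 0; and q · 1 = (1 + 1) ^ r.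
  1+1≡0 : 1# + 1# ≡ 0#
  1+1≡0 = pow≡0⇒≡0 r (trans (sym (∑-ones r)) q·1≡0)
    where
      q·1≡0 : ∑ {q} (λ _ → 1#) ≡ 0#
      q·1≡0 = x+y≡x⇒y≡0 (begin
        ∑ element + ∑ {q} (λ _ → 1#)  ≡⟨ sym (∑-distrib-+ element (λ _ → 1#)) ⟩
        ∑ (λ i → element i + 1#)      ≡⟨ ∑≡sum (λ i → element i + 1#) ⟩
        Additive.sum (λ i → element i + 1#) ≡⟨ sym (Reindexing.sum-bijection (CommutativeRing.+-commutativeMonoid commutativeRing) (translation 1#) id) ⟩
        Additive.sum element          ≡⟨ sym (∑≡sum element) ⟩
        ∑ element                     ∎)

  x+x≡0 : ∀ x → x + x ≡ 0#
  x+x≡0 x = begin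
    x + x              ≡⟨ x+x≡2x x ⟩
    (1# + 1#) * x      ≡⟨ cong (_* x) 1+1≡0 ⟩
    0# * x             ≡⟨ zeroˡ x ⟩
    0#                 ∎

  +-cancelʳ : ∀ x {a b} → a + x ≡ b + x → a ≡ b
  +-cancelʳ x {a} {b} e = trans (sym (a+x+x≡a a)) (trans (cong (_+ x) e) (a+x+x≡a b))
    where a+x+x≡a : ∀ a → a + x + x ≡ a
          a+x+x≡a a = trans (+-assoc a x x) (trans (cong (a +_) (x+x≡0 x)) (+-identityʳ a))

  cancel-zeros : ∀ {x y a b} → x + a ≡ y + b → a ≡ 0# → b ≡ 0# → x ≡ y
  cancel-zeros {x} {y} {a} {b} e a≡0 b≡0 = begin
    x        ≡⟨ +-identityʳ x ⟨
    x + 0#   ≡⟨ cong (x +_) a≡0 ⟨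
    x + a    ≡⟨ e ⟩
    y + b    ≡⟨ cong (y +_) b≡0 ⟩
    y + 0#   ≡⟨ +-identityʳ y ⟩
    y        ∎

  -x≡x : ∀ x → - x ≡ x
  -x≡x x = sym (+-inverseʳ-unique x x (x+x≡0 x))

  x+y≡0⇒y≡x : ∀ {x y} → x + y ≡ 0# → y ≡ x
  x+y≡0⇒y≡x {x} e = trans (+-inverseʳ-unique x _ e) (-x≡x x)

  sq : Carrier → Carrier
  sq x = x * x

  sq-+ : ∀ x y → sq (x + y) ≡ sq x + sq y
  sq-+ x y = begin
    sq (x + y)                          ≡⟨ solve 2 (λ x y → (x ⊕ y) ⊛ (x ⊕ y) ⊜ ((x ⊛ x ⊕ y ⊛ y) ⊕ (x ⊛ y ⊕ x ⊛ y))) refl x y ⟩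
    (sq x + sq y) + (x * y + x * y)     ≡⟨ cong (sq x + sq y +_) (x+x≡0 (x * y)) ⟩
    (sq x + sq y) + 0#                  ≡⟨ +-identityʳ _ ⟩
    sq x + sq y                         ∎

  sq-* : ∀ x y → sq (x * y) ≡ sq x * sq y
  sq-* = solve 2 (λ x y → (x ⊛ y) ⊛ (x ⊛ y) ⊜ ((x ⊛ x) ⊛ (y ⊛ y))) refl

  sq-∑ : ∀ {n} (f : Fin n → Carrier) → sq (∑ f) ≡ ∑ (sq ∘ f)
  sq-∑ {zero}  f = zeroˡ 0#
  sq-∑ {suc n} f = trans (sq-+ _ _) (cong (sq (f zero) +_) (sq-∑ (f ∘ suc)))

  sq≡0⇒≡0 : ∀ {x} → sq x ≡ 0# → x ≡ 0#
  sq≡0⇒≡0 = pow≡0⇒≡0 2 ∘ trans (cong (_ *_) (*-identityʳ _))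

  pow-double : ∀ x m → pow x (2 ℕ.* m) ≡ sq (pow x m)
  pow-double x m = trans (pow-+ x m (m ℕ.+ 0)) (cong (pow x m *_) (trans (pow-+ x m 0) (*-identityʳ _)))

  frobenius : ∀ k x y → pow (x + y) (2 ^ k) ≡ pow x (2 ^ k) + pow y (2 ^ k)
  frobenius zero    x y = trans (*-identityʳ _) (sym (cong₂ _+_ (*-identityʳ x) (*-identityʳ y)))
  frobenius (suc k) x y = begin
    pow (x + y) (2 ^ suc k)                  ≡⟨ pow-double (x + y) (2 ^ k) ⟩
    sq (pow (x + y) (2 ^ k))                 ≡⟨ cong sq (frobenius k x y) ⟩
    sq (pow x (2 ^ k) + pow y (2 ^ k))       ≡⟨ sq-+ _ _ ⟩
    sq (pow x (2 ^ k)) + sq (pow y (2 ^ k))  ≡⟨ sym (cong₂ _+_ (pow-double x (2 ^ k)) (pow-double y (2 ^ k))) ⟩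
    pow x (2 ^ suc k) + pow y (2 ^ suc k)    ∎

  -- For a ≠ 0, multiplying by a permutes the field.  Products over the field of
  -- x ↦ (x, or 1 when x = 0) then give a ^ q · P = a · P with P ≠ 0.
  pow-0# : ∀ m .{{_ : ℕ.NonZero m}} → pow 0# m ≡ 0#
  pow-0# (suc m) = zeroˡ (pow 0# m)

  fermat : ∀ a → pow a q ≡ a
  fermat a with a ≟ 0#
  ... | yes refl = pow-0# q {{m^n≢0 2 r}}
  ... | no a≢0 = *-cancelʳ (∏-≢0 (unit ∘ element) (unit≢0 ∘ element)) (begin
      pow a q * ∏ (unit ∘ element)                  ≡⟨ sym (∏-*-const a (unit ∘ element)) ⟩
      ∏ (λ i → a * unit (element i))                ≡⟨ Multiplicative.sum-cong-≗ (λ i → a*unit (element i)) ⟩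
      ∏ (λ i → correction (element i) * unit (a * element i)) ≡⟨ Multiplicative.∑-distrib-+ (correction ∘ element) _ ⟩
      ∏ (correction ∘ element) * ∏ (λ i → unit (a * element i)) ≡⟨ cong₂ _*_ ∏-correction (sym (Reindexing.sum-bijection (CommutativeRing.*-commutativeMonoid commutativeRing) (dilation a≢0) unit)) ⟩
      a * ∏ (unit ∘ element)                        ∎)
    where
      unit : Carrier → Carrier
      unit x with x ≟ 0#
      ... | yes _ = 1#
      ... | no  _ = x
      unit≢0 : ∀ x → unit x ≢ 0#
      unit≢0 x with x ≟ 0#
      ... | yes _   = 0≢1 ∘ sym
      ... | no  x≢0 = x≢0
      correction : Carrier → Carrier
      correction x with x ≟ 0#
      ... | yes _ = a
      ... | no  _ = 1#
      a*unit : ∀ x → a * unit x ≡ correction x * unit (a * x)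
      a*unit x with x ≟ 0# | a * x ≟ 0#
      ... | yes _    | yes _    = refl
      ... | yes refl | no  ax≢0 = contradiction (zeroʳ a) ax≢0
      ... | no  x≢0  | yes ax≡0 = contradiction ax≡0 (*-≢0 a≢0 x≢0)
      ... | no  _    | no  _    = sym (*-identityˡ _)
      ∏-correction : ∏ (correction ∘ element) ≡ a
      ∏-correction = trans (∏-single (correction ∘ element) (index 0#) away) (at0 (element (index 0#)) (element-index 0#))
        where
          away : ∀ l → l ≢ index 0# → correction (element l) ≡ 1#
          away l l≢ with element l ≟ 0#
          ... | yes e = contradiction (trans (sym (Inverse.strictlyInverseʳ enum l)) (cong index e)) l≢
          ... | no  _ = refl
          at0 : ∀ x → x ≡ 0# → correction x ≡ a
          at0 x x≡0 with x ≟ 0#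
          ... | yes _   = refl
          ... | no  x≢0 = contradiction x≡0 x≢0

module Polynomials (F : FiniteField2) where
  open FieldFacts F

  -- Horner form: p has degree ≤ d and its coefficient of x ^ d is c.
  Polynomial : ℕ → Carrier → (Carrier → Carrier) → Set
  Polynomial zero    c p = ∀ x → p x ≡ c
  Polynomial (suc d) c p = Σ Carrier λ a → Σ (Carrier → Carrier) λ p′ →
    Polynomial d c p′ × (∀ x → p x ≡ a + x * p′ x)

  Polynomial-resp : ∀ d {c p p′} → (∀ x → p x ≡ p′ x) → Polynomial d c p → Polynomial d c p′
  Polynomial-resp zero    e P x = trans (sym (e x)) (P x)
  Polynomial-resp (suc d) e (a , p₁ , P₁ , horner) = a , p₁ , P₁ , λ x → trans (sym (e x)) (horner x)

  0-polynomial : ∀ d → Polynomial d 0# (λ _ → 0#)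
  0-polynomial zero    x = refl
  0-polynomial (suc d) = 0# , (λ _ → 0#) , 0-polynomial d , λ x → sym (trans (+-identityˡ _) (zeroʳ x))

  raise-degree : ∀ d {c p} → Polynomial d c p → Polynomial (suc d) 0# p
  raise-degree zero    {c} P = c , (λ _ → 0#) , (λ _ → refl) , λ x → trans (P x) (sym (trans (cong (c +_) (zeroʳ x)) (+-identityʳ c)))
  raise-degree (suc d) (a , p₁ , P₁ , horner) = a , p₁ , raise-degree d P₁ , horner

  raise-degree-< : ∀ {d D c p} → d < D → Polynomial d c p → Polynomial D 0# p
  raise-degree-< {d} {suc D} d<D P with m≤n⇒m<n∨m≡n (ℕ.s≤s⁻¹ d<D)
  ... | inj₁ d<D′ = raise-degree D (raise-degree-< d<D′ P)
  ... | inj₂ refl = raise-degree d P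

  +-polynomial : ∀ d {c c′ p p′} → Polynomial d c p → Polynomial d c′ p′ → Polynomial d (c + c′) (λ x → p x + p′ x)
  +-polynomial zero    P P′ x = cong₂ _+_ (P x) (P′ x)
  +-polynomial (suc d) (a , p₁ , P₁ , horner) (a′ , p₂ , P₂ , horner′) =
    a + a′ , (λ x → p₁ x + p₂ x) , +-polynomial d P₁ P₂ , λ x → trans (cong₂ _+_ (horner x) (horner′ x))
      (solve 5 (λ a a′ x u v → (a ⊕ x ⊛ u) ⊕ (a′ ⊕ x ⊛ v) ⊜ ((a ⊕ a′) ⊕ x ⊛ (u ⊕ v))) refl a a′ x _ _)

  pow-polynomial : ∀ k → Polynomial k 1# (λ x → pow x k)
  pow-polynomial zero    x = refl
  pow-polynomial (suc k) = 0# , (λ x → pow x k) , pow-polynomial k , λ x → sym (+-identityˡ _)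

  private
    add-zero : ∀ x {z} → z ≡ 0# → x ≡ x + z
    add-zero x z≡0 = sym (trans (cong (x +_) z≡0) (+-identityʳ x))

    -a*c+a*c≡0 : ∀ a c → - a * c + a * c ≡ 0#
    -a*c+a*c≡0 a c = trans (cong (_+ a * c) (sym (-‿distribˡ-* a c))) (-‿inverseˡ (a * c))

  factor-theorem : ∀ d {c p} → Polynomial (suc d) c p → ∀ a →
    Σ (Carrier → Carrier) λ p′ → Polynomial d c p′ × (∀ x → p x ≡ (x - a) * p′ x + p a)
  factor-theorem zero {c} {p} (b , p₁ , P₁ , horner) a = p₁ , P₁ , λ x → begin
    p x                             ≡⟨ horner x ⟩
    b + x * p₁ x                    ≡⟨ cong (λ u → b + x * u) (P₁ x) ⟩
    b + x * c                       ≡⟨ add-zero (b + x * c) (-a*c+a*c≡0 a c) ⟩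
    b + x * c + (- a * c + a * c)   ≡⟨ solve 5 (λ b x a′ a c → b ⊕ x ⊛ c ⊕ (a′ ⊛ c ⊕ a ⊛ c) ⊜ ((x ⊕ a′) ⊛ c ⊕ (b ⊕ a ⊛ c))) refl b x (- a) a c ⟩
    (x - a) * c + (b + a * c)       ≡⟨ cong₂ (λ u v → (x - a) * u + (b + a * v)) (P₁ x) (P₁ a) ⟨
    (x - a) * p₁ x + (b + a * p₁ a) ≡⟨ cong ((x - a) * p₁ x +_) (horner a) ⟨
    (x - a) * p₁ x + p a            ∎
  factor-theorem (suc d) {c} {p} (b , p₁ , P₁ , horner) a
    with q₁ , Q₁ , factored ← factor-theorem d P₁ a =
    (λ x → p₁ a + x * q₁ x) , (p₁ a , q₁ , Q₁ , λ _ → refl) , λ x → begin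
      p x                                         ≡⟨ horner x ⟩
      b + x * p₁ x                                ≡⟨ cong (λ u → b + x * u) (factored x) ⟩
      b + x * ((x - a) * q₁ x + p₁ a)             ≡⟨ add-zero _ (-a*c+a*c≡0 a (p₁ a)) ⟩
      b + x * ((x - a) * q₁ x + p₁ a) + (- a * p₁ a + a * p₁ a)
        ≡⟨ solve 6 (λ b x a′ a u v → b ⊕ x ⊛ ((x ⊕ a′) ⊛ v ⊕ u) ⊕ (a′ ⊛ u ⊕ a ⊛ u) ⊜ ((x ⊕ a′) ⊛ (u ⊕ x ⊛ v) ⊕ (b ⊕ a ⊛ u))) refl b x (- a) a (p₁ a) (q₁ x) ⟩
      (x - a) * (p₁ a + x * q₁ x) + (b + a * p₁ a) ≡⟨ cong ((x - a) * (p₁ a + x * q₁ x) +_) (horner a) ⟨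
      (x - a) * (p₁ a + x * q₁ x) + p a           ∎

  roots-bound : ∀ d {c p} → Polynomial d c p → c ≢ 0# → (ρ : Fin (suc d) → Carrier) →
                (∀ i j → ρ i ≡ ρ j → i ≡ j) → ¬ (∀ i → p (ρ i) ≡ 0#)
  roots-bound zero    P c≢0 ρ ρ-injective roots = c≢0 (trans (sym (P (ρ zero))) (roots zero))
  roots-bound (suc d) {c} {p} P c≢0 ρ ρ-injective roots
    with q₁ , Q₁ , factored ← factor-theorem d P (ρ zero) =
    roots-bound d Q₁ c≢0 (ρ ∘ suc) (λ i j e → suc-injective (ρ-injective _ _ e)) q₁-roots
    where
      q₁-roots : ∀ i → q₁ (ρ (suc i)) ≡ 0#
      q₁-roots i = x*y≡0⇒y≡0 ρᵢ-ρ₀≢0 (begin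
        (ρ (suc i) - ρ zero) * q₁ (ρ (suc i))         ≡⟨ +-identityʳ _ ⟨
        (ρ (suc i) - ρ zero) * q₁ (ρ (suc i)) + 0#    ≡⟨ cong ((ρ (suc i) - ρ zero) * q₁ (ρ (suc i)) +_) (roots zero) ⟨
        (ρ (suc i) - ρ zero) * q₁ (ρ (suc i)) + p (ρ zero) ≡⟨ factored (ρ (suc i)) ⟨
        p (ρ (suc i))                                 ≡⟨ roots (suc i) ⟩
        0#                                            ∎)
        where
          ρᵢ-ρ₀≢0 : ρ (suc i) - ρ zero ≢ 0#
          ρᵢ-ρ₀≢0 e with () ← ρ-injective (suc i) zero (x-y≡0⇒x≡y e)

  ∑-pow-polynomial : ∀ {k} D (g : Fin k → ℕ) → (∀ i → g i < D) → Polynomial D 0# (λ x → ∑ (λ i → pow x (g i)))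
  ∑-pow-polynomial {zero}  D g g<D = 0-polynomial D
  ∑-pow-polynomial {suc k} D g g<D = subst (λ c → Polynomial D c (λ x → ∑ (λ i → pow x (g i)))) (+-identityˡ 0#)
    (+-polynomial D (raise-degree-< (g<D zero) (pow-polynomial (g zero))) (∑-pow-polynomial D (g ∘ suc) (g<D ∘ suc)))

module Trace (F : FiniteField2) where
  open Characteristic2 F public
  open Polynomials F

  partial-tr : ℕ → Carrier → Carrier
  partial-tr k x = ∑ {k} (λ i → pow x (2 ^ toℕ i))

  partial-tr-suc : ∀ k x → partial-tr (suc k) x ≡ partial-tr k x + pow x (2 ^ k)
  partial-tr-suc k x = trans (∑-init-last {k} (λ i → pow x (2 ^ toℕ i)))
    (cong₂ _+_ (∑-cong {k} (λ i → cong (λ m → pow x (2 ^ m)) (toℕ-inject₁ i))) (cong (λ m → pow x (2 ^ m)) (toℕ-fromℕ k)))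

  pow-sq : ∀ x m → pow (sq x) m ≡ sq (pow x m)
  pow-sq x m = pow-*-distrib x x m

  partial-tr-sq : ∀ k x → partial-tr k (sq x) + x ≡ partial-tr k x + pow x (2 ^ k)
  partial-tr-sq zero    x = cong (0# +_) (sym (*-identityʳ x))
  partial-tr-sq (suc k) x = begin
    partial-tr (suc k) (sq x) + x                          ≡⟨ cong (_+ x) (partial-tr-suc k (sq x)) ⟩
    partial-tr k (sq x) + pow (sq x) (2 ^ k) + x           ≡⟨ solve 3 (λ a b x → a ⊕ b ⊕ x ⊜ (a ⊕ x ⊕ b)) refl _ _ x ⟩
    partial-tr k (sq x) + x + pow (sq x) (2 ^ k)           ≡⟨ cong₂ _+_ (partial-tr-sq k x) (trans (pow-sq x (2 ^ k)) (sym (pow-double x (2 ^ k)))) ⟩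
    partial-tr k x + pow x (2 ^ k) + pow x (2 ^ suc k)     ≡⟨ cong (_+ pow x (2 ^ suc k)) (partial-tr-suc k x) ⟨
    partial-tr (suc k) x + pow x (2 ^ suc k)               ∎

  sq-partial-tr : ∀ k x → sq (partial-tr k x) ≡ partial-tr k (sq x)
  sq-partial-tr k x = trans (sq-∑ {k} (λ i → pow x (2 ^ toℕ i))) (∑-cong {k} (λ i → sym (pow-sq x (2 ^ toℕ i))))

  tr-+ : ∀ x y → tr (x + y) ≡ tr x + tr y
  tr-+ x y = trans (∑-cong {r} (λ i → frobenius (toℕ i) x y)) (∑-distrib-+ {r} _ _)

  tr-sq : ∀ x → tr (sq x) ≡ tr x
  tr-sq x = +-cancelʳ x (trans (partial-tr-sq r x) (cong (tr x +_) (fermat x)))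

  tr-sq+id : ∀ y → tr (sq y + y) ≡ 0#
  tr-sq+id y = trans (tr-+ (sq y) y) (trans (cong (_+ tr y) (tr-sq y)) (x+x≡0 (tr y)))

  tr≢0⇒tr≡1 : ∀ {x} → tr x ≢ 0# → tr x ≡ 1#
  tr≢0⇒tr≡1 {x} tr≢0 = *-cancelʳ tr≢0 (trans (trans (sq-partial-tr r x) (tr-sq x)) (sym (*-identityˡ (tr x))))

  private
    r≡suc : Σ ℕ λ k → r ≡ suc k
    r≡suc with r in r≡
    ... | suc k = k , refl
    ... | zero  = contradiction (begin
      0#                    ≡⟨ element-index 0# ⟨
      element (index 0#)    ≡⟨ cong element (Fin1-irrelevant (cong (2 ^_) r≡) (index 0#) (index 1#)) ⟩
      element (index 1#)    ≡⟨ element-index 1# ⟩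
      1#                    ∎) 0≢1
      where Fin1-irrelevant : ∀ {n} → n ≡ 1 → (i j : Fin n) → i ≡ j
            Fin1-irrelevant refl zero zero = refl

  -- For r = suc k, tr = partial-tr (suc k) has degree 2 ^ k < q, so it cannot vanish everywhere.
  tr-not-identically-0 : ¬ (∀ x → tr x ≡ 0#)
  tr-not-identically-0 tr≡0 with k , r≡1+k ← r≡suc =
    roots-bound (2 ^ k) tr-polynomial (0≢1 ∘ sym) (λ i → element (inject≤ i 2^k<q))
      (λ i j e → inject≤-injective 2^k<q 2^k<q i j (element-injective e))
      (λ i → subst (λ m → partial-tr m (element (inject≤ i 2^k<q)) ≡ 0#) r≡1+k (tr≡0 _))
    where
      2^k<q : suc (2 ^ k) ≤ q
      2^k<q = subst (λ m → suc (2 ^ k) ≤ 2 ^ m) (sym r≡1+k) (^-monoʳ-< 2 (s≤s (s≤s z≤n)) (n<1+n k))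
      tr-polynomial : Polynomial (2 ^ k) 1# (partial-tr (suc k))
      tr-polynomial = Polynomial-resp (2 ^ k) (λ x → sym (partial-tr-suc k x))
        (subst (λ c → Polynomial (2 ^ k) c (λ x → partial-tr k x + pow x (2 ^ k))) (+-identityˡ 1#)
          (+-polynomial (2 ^ k)
            (∑-pow-polynomial {k} (2 ^ k) (λ i → 2 ^ toℕ i) (λ i → ^-monoʳ-< 2 (s≤s (s≤s z≤n)) (toℕ<n i)))
            (pow-polynomial (2 ^ k))))

  ∃tr≡1 : Σ Carrier λ δ → tr δ ≡ 1#
  ∃tr≡1 with all? (λ i → tr (element i) ≟ 0#)
  ... | yes all≡0 = contradiction (λ x → subst (λ y → tr y ≡ 0#) (element-index x) (all≡0 (index x))) tr-not-identically-0
  ... | no  ¬all≡0 with i , tr≢0 ← ¬∀⟶∃¬ q _ (λ i → tr (element i) ≟ 0#) ¬all≡0 = element i , tr≢0⇒tr≡1 tr≢0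

  -- Partial sums of y = ∑_{k<r} partial-tr k c · δ ^ (2 ^ k), which solves y² + y = c
  -- when tr c = 0 and tr δ = 1 (additive Hilbert 90).
  module _ (c δ : Carrier) where
    hilbert90-partial : ℕ → Carrier
    hilbert90-partial zero    = 0#
    hilbert90-partial (suc k) = hilbert90-partial k + partial-tr k c * pow δ (2 ^ k)

    sq+id-hilbert90-partial : ∀ k → sq (hilbert90-partial k) + hilbert90-partial k ≡
                                    pow δ (2 ^ k) * (partial-tr k c + c) + c * (partial-tr k δ + δ)
    sq+id-hilbert90-partial zero = begin
      0# * 0# + 0#                                      ≡⟨ trans (+-identityʳ _) (zeroˡ 0#) ⟩
      0#                                                ≡⟨ x+x≡0 (δ * c) ⟨
      δ * c + δ * c                                     ≡⟨ cong (δ * c +_) (*-comm δ c) ⟩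
      δ * c + c * δ                                     ≡⟨ cong₂ _+_ (cong₂ _*_ (*-identityʳ δ) (+-identityˡ c)) (cong (c *_) (+-identityˡ δ)) ⟨
      δ * 1# * (0# + c) + c * (0# + δ)                  ∎
    sq+id-hilbert90-partial (suc k) = begin
      sq (y + C * d) + (y + C * d)
        ≡⟨ cong (_+ (y + C * d)) (trans (sq-+ y (C * d)) (cong (sq y +_) (trans (sq-* C d) (cong (sq C *_) (sym (pow-double δ (2 ^ k))))))) ⟩
      sq y + sq C * d′ + (y + C * d)
        ≡⟨ solve 5 (λ SY Y S d′ Cd → SY ⊕ S ⊛ d′ ⊕ (Y ⊕ Cd) ⊜ ((SY ⊕ Y) ⊕ S ⊛ d′ ⊕ Cd)) refl (sq y) y (sq C) d′ (C * d) ⟩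
      sq y + y + sq C * d′ + C * d
        ≡⟨ cong (λ u → u + sq C * d′ + C * d) (sq+id-hilbert90-partial k) ⟩
      d * (C + c) + c * (D + δ) + sq C * d′ + C * d
        ≡⟨ cancel-zeros
             (solve 7 (λ d C c D δ S d′ → d ⊛ (C ⊕ c) ⊕ c ⊛ (D ⊕ δ) ⊕ S ⊛ d′ ⊕ C ⊛ d ⊕ d′ ⊛ (c ⊕ c)
                                        ⊜ (d′ ⊛ (S ⊕ c ⊕ c) ⊕ c ⊛ (D ⊕ d ⊕ δ) ⊕ (d ⊛ C ⊕ C ⊛ d))) refl d C c D δ (sq C) d′)
             (trans (cong (d′ *_) (x+x≡0 c)) (zeroʳ d′))
             (trans (cong (d * C +_) (*-comm C d)) (x+x≡0 (d * C))) ⟩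
      d′ * (sq C + c + c) + c * (D + d + δ)
        ≡⟨ cong₂ (λ u v → d′ * (u + c) + c * (v + δ)) sqC+c≡C′ (sym (partial-tr-suc k δ)) ⟩
      d′ * (partial-tr (suc k) c + c) + c * (partial-tr (suc k) δ + δ) ∎
      where
        y = hilbert90-partial k
        C = partial-tr k c
        D = partial-tr k δ
        d = pow δ (2 ^ k)
        d′ = pow δ (2 ^ suc k)
        sqC+c≡C′ : sq C + c ≡ partial-tr (suc k) c
        sqC+c≡C′ = trans (cong (_+ c) (sq-partial-tr k c)) (trans (partial-tr-sq k c) (sym (partial-tr-suc k c)))

  tr≡0⇒sq+id-surjective : ∀ {c} → tr c ≡ 0# → Σ Carrier λ y → sq y + y ≡ c
  tr≡0⇒sq+id-surjective {c} tr-c≡0 with δ , tr-δ≡1 ← ∃tr≡1 = hilbert90-partial c δ r , (begin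
    sq (hilbert90-partial c δ r) + hilbert90-partial c δ r ≡⟨ sq+id-hilbert90-partial c δ r ⟩
    pow δ q * (tr c + c) + c * (tr δ + δ)                 ≡⟨ cong₂ (λ u v → u * v + c * (tr δ + δ)) (fermat δ) (trans (cong (_+ c) tr-c≡0) (+-identityˡ c)) ⟩
    δ * c + c * (tr δ + δ)                                ≡⟨ cong (λ t → δ * c + c * (t + δ)) tr-δ≡1 ⟩
    δ * c + c * (1# + δ)                                  ≡⟨ solve 3 (λ δ c one → δ ⊛ c ⊕ c ⊛ (one ⊕ δ) ⊜ (c ⊛ one ⊕ (c ⊛ δ ⊕ c ⊛ δ))) refl δ c 1# ⟩
    c * 1# + (c * δ + c * δ)                              ≡⟨ cong₂ _+_ (*-identityʳ c) (x+x≡0 (c * δ)) ⟩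
    c + 0#                                                ≡⟨ +-identityʳ c ⟩
    c                                                     ∎)

module Matrices (F : FiniteField2) where
  open Trace F public

  ≋-refl : ∀ {m n} {A : Mat m n} → A ≋ A
  ≋-refl i j = refl

  ≋-sym : ∀ {m n} {A B : Mat m n} → A ≋ B → B ≋ A
  ≋-sym e i j = sym (e i j)

  ≋-trans : ∀ {m n} {A B C : Mat m n} → A ≋ B → B ≋ C → A ≋ C
  ≋-trans e f i j = trans (e i j) (f i j)

  infix 4 _≋?_
  _≋?_ : ∀ {m n} (A B : Mat m n) → Dec (A ≋ B)
  A ≋? B = all? λ i → all? λ j → A i j ≟ B i j

  matrixDecSetoid : ℕ → DecSetoid 0ℓ 0ℓ
  matrixDecSetoid n = record
    { Carrier = Mat n n
    ; _≈_ = _≋_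
    ; isDecEquivalence = record
      { isEquivalence = record { refl = ≋-refl ; sym = ≋-sym ; trans = ≋-trans }
      ; _≟_ = _≋?_
      }
    }

  matrices : ∀ n → List (Mat n n)
  matrices n = vectors n (vectors n elements)

  matrices-isEnumeration : ∀ n → IsEnumeration (DecSetoid.setoid (matrixDecSetoid n)) (matrices n)
  matrices-isEnumeration n =
    vectors-isEnumeration (Pointwise.setoid (≡.setoid Carrier) n)
      (vectors-isEnumeration (≡.setoid Carrier) elements-isEnumeration n) n

  module Finite n = FiniteDecSetoid (matrixDecSetoid n) (matrices-isEnumeration n)

  mat₂ : Carrier → Carrier → Carrier → Carrier → Mat 2 2
  mat₂ a b c d zero       zero       = a
  mat₂ a b c d zero       (suc zero) = b
  mat₂ a b c d (suc zero) zero       = c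
  mat₂ a b c d (suc zero) (suc zero) = d

  mat₂-cong : ∀ {a b c d a′ b′ c′ d′} → a ≡ a′ → b ≡ b′ → c ≡ c′ → d ≡ d′ → mat₂ a b c d ≋ mat₂ a′ b′ c′ d′
  mat₂-cong a≡ b≡ c≡ d≡ zero       zero       = a≡
  mat₂-cong a≡ b≡ c≡ d≡ zero       (suc zero) = b≡
  mat₂-cong a≡ b≡ c≡ d≡ (suc zero) zero       = c≡
  mat₂-cong a≡ b≡ c≡ d≡ (suc zero) (suc zero) = d≡

  mat₂-⊗ : ∀ a b c d a′ b′ c′ d′ → (mat₂ a b c d ⊗ mat₂ a′ b′ c′ d′) ≋
    mat₂ (a * a′ + b * c′) (a * b′ + b * d′) (c * a′ + d * c′) (c * b′ + d * d′)
  mat₂-⊗ a b c d a′ b′ c′ d′ zero       zero       = cong (a * a′ +_) (+-identityʳ (b * c′))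
  mat₂-⊗ a b c d a′ b′ c′ d′ zero       (suc zero) = cong (a * b′ +_) (+-identityʳ (b * d′))
  mat₂-⊗ a b c d a′ b′ c′ d′ (suc zero) zero       = cong (c * a′ +_) (+-identityʳ (d * c′))
  mat₂-⊗ a b c d a′ b′ c′ d′ (suc zero) (suc zero) = cong (c * b′ +_) (+-identityʳ (d * d′))

  mat₂-η : ∀ X → X ≋ mat₂ (X zero zero) (X zero (suc zero)) (X (suc zero) zero) (X (suc zero) (suc zero))
  mat₂-η X zero       zero       = refl
  mat₂-η X zero       (suc zero) = refl
  mat₂-η X (suc zero) zero       = refl
  mat₂-η X (suc zero) (suc zero) = refl

  mat₂-I : mat₂ 1# 0# 0# 1# ≋ I 2
  mat₂-I zero       zero       = refl
  mat₂-I zero       (suc zero) = refl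
  mat₂-I (suc zero) zero       = refl
  mat₂-I (suc zero) (suc zero) = refl

  ⊗-cong : ∀ {m k n} {A A′ : Mat m k} {B B′ : Mat k n} → A ≋ A′ → B ≋ B′ → (A ⊗ B) ≋ (A′ ⊗ B′)
  ⊗-cong A≋A′ B≋B′ i j = ∑-cong (λ l → cong₂ _*_ (A≋A′ i l) (B≋B′ l j))

  Tr-cong : ∀ {n} {A B : Mat n n} → A ≋ B → Tr A ≡ Tr B
  Tr-cong A≋B = ∑-cong (λ i → A≋B i i)

  transpose-cong : ∀ {n} {A B : Mat n n} → A ≋ B → transpose A ≋ transpose B
  transpose-cong A≋B i j = A≋B j i

  I-diagonal : ∀ {n} (i : Fin n) → I n i i ≡ 1#
  I-diagonal i with i Fin.≟ i
  ... | yes _  = refl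
  ... | no i≢i = contradiction refl i≢i

  I-off-diagonal : ∀ {n} {i j : Fin n} → i ≢ j → I n i j ≡ 0#
  I-off-diagonal {i = i} {j} i≢j with i Fin.≟ j
  ... | yes i≡j = contradiction i≡j i≢j
  ... | no  _   = refl

  I-reindex : ∀ {m k} (f : Fin m → Fin k) → (∀ {i j} → f i ≡ f j → i ≡ j) → ∀ i j → I m i j ≡ I k (f i) (f j)
  I-reindex f f-injective i j with i Fin.≟ j
  ... | yes refl = sym (I-diagonal (f i))
  ... | no  i≢j  = sym (I-off-diagonal (i≢j ∘ f-injective))

  transpose-I : ∀ {n} → transpose (I n) ≋ I n
  transpose-I i j with i Fin.≟ j | j Fin.≟ i
  ... | yes _   | yes _   = refl
  ... | no  _   | no  _   = refl
  ... | yes i≡j | no  j≢i = contradiction (sym i≡j) j≢i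
  ... | no  i≢j | yes j≡i = contradiction (sym j≡i) i≢j

  ⊗-identityˡ : ∀ {m n} (X : Mat m n) → (I m ⊗ X) ≋ X
  ⊗-identityˡ X i j =
    trans (∑-single _ i (λ l l≢i → trans (cong (_* X l j) (I-off-diagonal (l≢i ∘ sym))) (zeroˡ _)))
          (trans (cong (_* X i j) (I-diagonal i)) (*-identityˡ _))

  ⊗-identityʳ : ∀ {m n} (X : Mat m n) → (X ⊗ I n) ≋ X
  ⊗-identityʳ X i j =
    trans (∑-single _ j (λ l l≢j → trans (cong (X i l *_) (I-off-diagonal l≢j)) (zeroʳ _)))
          (trans (cong (X i j *_) (I-diagonal j)) (*-identityʳ _))

  ⊗-zeroˡ : ∀ {m k n} (X : Mat k n) → (O m k ⊗ X) ≋ O m n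
  ⊗-zeroˡ X i j = ∑-zero _ (λ l → zeroˡ (X l j))

  ⊗-zeroʳ : ∀ {m k n} (X : Mat m k) → (X ⊗ O k n) ≋ O m n
  ⊗-zeroʳ X i j = ∑-zero _ (λ l → zeroʳ (X i l))

  infixl 6 _⊞_
  _⊞_ : ∀ {m n} → Mat m n → Mat m n → Mat m n
  (A ⊞ B) i j = A i j + B i j

  ⊗-distribˡ-⊞ : ∀ {m k n} (X : Mat m k) (A B : Mat k n) → (X ⊗ (A ⊞ B)) ≋ ((X ⊗ A) ⊞ (X ⊗ B))
  ⊗-distribˡ-⊞ {k = k} X A B i j = trans (∑-cong (λ l → distribˡ (X i l) (A l j) (B l j))) (∑-distrib-+ {k} _ _)

  ⊗-distribʳ-⊞ : ∀ {m k n} (X : Mat k n) (A B : Mat m k) → ((A ⊞ B) ⊗ X) ≋ ((A ⊗ X) ⊞ (B ⊗ X))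
  ⊗-distribʳ-⊞ {k = k} X A B i j = trans (∑-cong (λ l → distribʳ (X l j) (A i l) (B i l))) (∑-distrib-+ {k} _ _)

  Tr-⊞ : ∀ {n} (A B : Mat n n) → Tr (A ⊞ B) ≡ Tr A + Tr B
  Tr-⊞ {n} A B = ∑-distrib-+ {n} (λ i → A i i) (λ i → B i i)

  Tr-O : ∀ n → Tr (O n n) ≡ 0#
  Tr-O n = ∑-zero {n} _ (λ _ → refl)

  Tr-⊗-diagonalˡ : ∀ {n} (D X : Mat n n) → (∀ {i j} → i ≢ j → D i j ≡ 0#) → Tr (D ⊗ X) ≡ ∑ (λ i → D i i * X i i)
  Tr-⊗-diagonalˡ D X D-diagonal = ∑-cong λ i →
    ∑-single (λ l → D i l * X l i) i (λ l l≢i → trans (cong (_* X l i) (D-diagonal (l≢i ∘ sym))) (zeroˡ _))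

  module _ {n : ℕ} where
    ↑-elim : (P : Fin (n ℕ.+ n) → Set) → (∀ i → P (i ↑ˡ n)) → (∀ i → P (n ↑ʳ i)) → ∀ x → P x
    ↑-elim P left right x with splitAt n x in eq
    ... | inj₁ i = subst P (splitAt⁻¹-↑ˡ eq) (left i)
    ... | inj₂ i = subst P (splitAt⁻¹-↑ʳ eq) (right i)

    quadrant-ext : {X Y : Mat (n ℕ.+ n) (n ℕ.+ n)} →
      (∀ i j → X (i ↑ˡ n) (j ↑ˡ n) ≡ Y (i ↑ˡ n) (j ↑ˡ n)) → (∀ i j → X (i ↑ˡ n) (n ↑ʳ j) ≡ Y (i ↑ˡ n) (n ↑ʳ j)) →
      (∀ i j → X (n ↑ʳ i) (j ↑ˡ n) ≡ Y (n ↑ʳ i) (j ↑ˡ n)) → (∀ i j → X (n ↑ʳ i) (n ↑ʳ j) ≡ Y (n ↑ʳ i) (n ↑ʳ j)) →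
      X ≋ Y
    quadrant-ext {X} {Y} e₁₁ e₁₂ e₂₁ e₂₂ x y =
      ↑-elim (λ x → X x y ≡ Y x y)
        (λ i → ↑-elim (λ y → X (i ↑ˡ n) y ≡ Y (i ↑ˡ n) y) (e₁₁ i) (e₁₂ i) y)
        (λ i → ↑-elim (λ y → X (n ↑ʳ i) y ≡ Y (n ↑ʳ i) y) (e₂₁ i) (e₂₂ i) y) x

    module _ (A B C D : Mat n n) (i j : Fin n) where
      block₁₁ : block A B C D (i ↑ˡ n) (j ↑ˡ n) ≡ A i j
      block₁₁ rewrite splitAt-↑ˡ n i n | splitAt-↑ˡ n j n = refl
      block₁₂ : block A B C D (i ↑ˡ n) (n ↑ʳ j) ≡ B i j
      block₁₂ rewrite splitAt-↑ˡ n i n | splitAt-↑ʳ n n j = refl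
      block₂₁ : block A B C D (n ↑ʳ i) (j ↑ˡ n) ≡ C i j
      block₂₁ rewrite splitAt-↑ʳ n n i | splitAt-↑ˡ n j n = refl
      block₂₂ : block A B C D (n ↑ʳ i) (n ↑ʳ j) ≡ D i j
      block₂₂ rewrite splitAt-↑ʳ n n i | splitAt-↑ʳ n n j = refl

    block-cong : ∀ {A B C D A′ B′ C′ D′ : Mat n n} → A ≋ A′ → B ≋ B′ → C ≋ C′ → D ≋ D′ →
                 block A B C D ≋ block A′ B′ C′ D′
    block-cong A≋ B≋ C≋ D≋ = quadrant-ext
      (λ i j → trans (block₁₁ _ _ _ _ i j) (trans (A≋ i j) (sym (block₁₁ _ _ _ _ i j))))
      (λ i j → trans (block₁₂ _ _ _ _ i j) (trans (B≋ i j) (sym (block₁₂ _ _ _ _ i j))))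
      (λ i j → trans (block₂₁ _ _ _ _ i j) (trans (C≋ i j) (sym (block₂₁ _ _ _ _ i j))))
      (λ i j → trans (block₂₂ _ _ _ _ i j) (trans (D≋ i j) (sym (block₂₂ _ _ _ _ i j))))

    block-⊗ : ∀ (A B C D A′ B′ C′ D′ : Mat n n) →
      (block A B C D ⊗ block A′ B′ C′ D′) ≋
        block ((A ⊗ A′) ⊞ (B ⊗ C′)) ((A ⊗ B′) ⊞ (B ⊗ D′)) ((C ⊗ A′) ⊞ (D ⊗ C′)) ((C ⊗ B′) ⊞ (D ⊗ D′))
    block-⊗ A B C D A′ B′ C′ D′ = quadrant-ext
      (λ i j → entry (block₁₁ _ _ _ _ i) (block₁₂ _ _ _ _ i) (λ l → block₁₁ _ _ _ _ l j) (λ l → block₂₁ _ _ _ _ l j) (block₁₁ _ _ _ _ i j))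
      (λ i j → entry (block₁₁ _ _ _ _ i) (block₁₂ _ _ _ _ i) (λ l → block₁₂ _ _ _ _ l j) (λ l → block₂₂ _ _ _ _ l j) (block₁₂ _ _ _ _ i j))
      (λ i j → entry (block₂₁ _ _ _ _ i) (block₂₂ _ _ _ _ i) (λ l → block₁₁ _ _ _ _ l j) (λ l → block₂₁ _ _ _ _ l j) (block₂₁ _ _ _ _ i j))
      (λ i j → entry (block₂₁ _ _ _ _ i) (block₂₂ _ _ _ _ i) (λ l → block₁₂ _ _ _ _ l j) (λ l → block₂₂ _ _ _ _ l j) (block₂₂ _ _ _ _ i j))
      where
        entry : ∀ {x y : Fin (n ℕ.+ n)} {P Q R S : Fin n → Carrier} {t} →
          (∀ l → block A B C D x (l ↑ˡ n) ≡ P l) → (∀ l → block A B C D x (n ↑ʳ l) ≡ Q l) →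
          (∀ l → block A′ B′ C′ D′ (l ↑ˡ n) y ≡ R l) → (∀ l → block A′ B′ C′ D′ (n ↑ʳ l) y ≡ S l) →
          t ≡ ∑ (λ l → P l * R l) + ∑ (λ l → Q l * S l) →
          (block A B C D ⊗ block A′ B′ C′ D′) x y ≡ t
        entry p q r s t≡ = trans (∑-++ n _) (trans (cong₂ _+_ (∑-cong (λ l → cong₂ _*_ (p l) (r l))) (∑-cong (λ l → cong₂ _*_ (q l) (s l)))) (sym t≡))

    block-identity : block (I n) (O n n) (O n n) (I n) ≋ I (n ℕ.+ n)
    block-identity = quadrant-ext
      (λ i j → trans (block₁₁ _ _ _ _ i j) (I-reindex (_↑ˡ n) (↑ˡ-injective n _ _) i j))
      (λ i j → trans (block₁₂ _ _ _ _ i j) (sym (I-off-diagonal (↑ˡ≢↑ʳ i j))))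
      (λ i j → trans (block₂₁ _ _ _ _ i j) (sym (I-off-diagonal (↑ˡ≢↑ʳ j i ∘ sym))))
      (λ i j → trans (block₂₂ _ _ _ _ i j) (I-reindex (n ↑ʳ_) (↑ʳ-injective n _ _) i j))
      where
        ↑ˡ≢↑ʳ : ∀ i j → i ↑ˡ n ≢ n ↑ʳ j
        ↑ˡ≢↑ʳ i j e with () ← trans (sym (splitAt-↑ˡ n i n)) (trans (cong (splitAt n) e) (splitAt-↑ʳ n n j))

    Tr-block : ∀ (A B C D : Mat n n) → Tr (block A B C D) ≡ Tr A + Tr D
    Tr-block A B C D = trans (∑-++ n _) (cong₂ _+_ (∑-cong (λ i → block₁₁ A B C D i i)) (∑-cong (λ i → block₂₂ A B C D i i)))

module DoubleCosets (F : FiniteField2) where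
  open Matrices F public

  Pmat : ∀ {n} → Mat n n → Mat n n → Mat n n → Mat (n ℕ.+ n) (n ℕ.+ n)
  Pmat {n} A A′ B = block A (O n n) (O n n) (transpose A′) ⊗ block (I n) B (O n n) (I n)

  Pmat-InP : ∀ {n} {A A′ B : Mat n n} → IsInverse A A′ → SymZeroDiag B → InP n (Pmat A A′ B)
  Pmat-InP {A = A} {A′} {B} inverse symmetric = A , A′ , B , inverse , symmetric , ≋-refl

  Pmat-cong : ∀ {n} {A A′ B C C′ D : Mat n n} → A ≋ C → A′ ≋ C′ → B ≋ D → Pmat A A′ B ≋ Pmat C C′ D
  Pmat-cong A≋C A′≋C′ B≋D =
    ⊗-cong (block-cong A≋C ≋-refl ≋-refl (transpose-cong A′≋C′)) (block-cong ≋-refl B≋D ≋-refl ≋-refl)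

  Pmat-block : ∀ {n} (A A′ B : Mat n n) → Pmat A A′ B ≋ block A (A ⊗ B) (O n n) (transpose A′)
  Pmat-block {n} A A′ B = ≋-trans (block-⊗ A (O n n) (O n n) (transpose A′) (I n) B (O n n) (I n)) (block-cong
    (λ i j → trans (cong₂ _+_ (⊗-identityʳ A i j) (⊗-zeroˡ (O n n) i j)) (+-identityʳ _))
    (λ i j → trans (cong ((A ⊗ B) i j +_) (⊗-zeroˡ (I n) i j)) (+-identityʳ _))
    (λ i j → trans (cong₂ _+_ (⊗-zeroˡ (I n) i j) (⊗-zeroʳ (transpose A′) i j)) (+-identityʳ _))
    (λ i j → trans (cong₂ _+_ (⊗-zeroˡ B i j) (⊗-identityʳ (transpose A′) i j)) (+-identityˡ _)))

  Pmat-identity : ∀ {n} → Pmat (I n) (I n) (O n n) ≋ block (I n) (O n n) (O n n) (I n)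
  Pmat-identity {n} = ≋-trans (Pmat-block (I n) (I n) (O n n)) (block-cong ≋-refl (⊗-zeroʳ (I n)) ≋-refl transpose-I)

  block-identityˡ : ∀ {n} (A B C D : Mat n n) → (block (I n) (O n n) (O n n) (I n) ⊗ block A B C D) ≋ block A B C D
  block-identityˡ {n} A B C D = ≋-trans (block-⊗ (I n) (O n n) (O n n) (I n) A B C D) (block-cong
    (λ i j → trans (cong₂ _+_ (⊗-identityˡ A i j) (⊗-zeroˡ C i j)) (+-identityʳ _))
    (λ i j → trans (cong₂ _+_ (⊗-identityˡ B i j) (⊗-zeroˡ D i j)) (+-identityʳ _))
    (λ i j → trans (cong₂ _+_ (⊗-zeroˡ A i j) (⊗-identityˡ C i j)) (+-identityˡ _))
    (λ i j → trans (cong₂ _+_ (⊗-zeroˡ B i j) (⊗-identityˡ D i j)) (+-identityˡ _)))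

  IsInverse-resp : ∀ {n} {A A′ C C′ : Mat n n} → A ≋ C → A′ ≋ C′ → IsInverse A A′ → IsInverse C C′
  IsInverse-resp A≋C A′≋C′ (right , left) =
    ≋-trans (⊗-cong (≋-sym A≋C) (≋-sym A′≋C′)) right , ≋-trans (⊗-cong (≋-sym A′≋C′) (≋-sym A≋C)) left

  SymZeroDiag-resp : ∀ {n} {B D : Mat n n} → B ≋ D → SymZeroDiag B → SymZeroDiag D
  SymZeroDiag-resp B≋D (symmetric , zero-diagonal) =
    (λ i j → trans (sym (B≋D i j)) (trans (symmetric i j) (B≋D j i))) , λ i → trans (sym (B≋D i i)) (zero-diagonal i)

  IsInverse? : ∀ {n} (A A′ : Mat n n) → Dec (IsInverse A A′)
  IsInverse? {n} A A′ = ((A ⊗ A′) ≋? I n) ×-dec ((A′ ⊗ A) ≋? I n)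

  SymZeroDiag? : ∀ {n} (B : Mat n n) → Dec (SymZeroDiag B)
  SymZeroDiag? B = all? (λ i → all? λ j → B i j ≟ B j i) ×-dec all? (λ i → B i i ≟ 0#)

  InP-resp : ∀ {n} → InP n Respects _≋_
  InP-resp p≋p′ (A , A′ , B , inverse , symmetric , p≋) = A , A′ , B , inverse , symmetric , ≋-trans (≋-sym p≋p′) p≋

  InP? : ∀ n → Decidable (InP n)
  InP? n p = Finite.∃? n respA λ A → Finite.∃? n (respA′ A) λ A′ → Finite.∃? n (respB A A′) λ B →
               IsInverse? A A′ ×-dec SymZeroDiag? B ×-dec p ≋? Pmat A A′ B
    where
      respB : ∀ A A′ → (λ B → IsInverse A A′ × SymZeroDiag B × p ≋ Pmat A A′ B) Respects _≋_
      respB A A′ B≋D (inverse , symmetric , p≋) =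
        inverse , SymZeroDiag-resp B≋D symmetric , ≋-trans p≋ (Pmat-cong (≋-refl {A = A}) (≋-refl {A = A′}) B≋D)
      respA′ : ∀ A → (λ A′ → ∃ λ B → IsInverse A A′ × SymZeroDiag B × p ≋ Pmat A A′ B) Respects _≋_
      respA′ A A′≋C′ (B , inverse , symmetric , p≋) =
        B , IsInverse-resp ≋-refl A′≋C′ inverse , symmetric , ≋-trans p≋ (Pmat-cong (≋-refl {A = A}) A′≋C′ (≋-refl {A = B}))
      respA : (λ A → ∃ λ A′ → ∃ λ B → IsInverse A A′ × SymZeroDiag B × p ≋ Pmat A A′ B) Respects _≋_
      respA A≋C (A′ , B , inverse , symmetric , p≋) =
        A′ , B , IsInverse-resp A≋C ≋-refl inverse , symmetric , ≋-trans p≋ (Pmat-cong A≋C (≋-refl {A = A′}) (≋-refl {A = B}))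

  InDC-resp : ∀ {n s} → InDC n s Respects _≋_
  InDC-resp w≋w′ (p₁ , p₂ , p₁∈P , p₂∈P , w≋) = p₁ , p₂ , p₁∈P , p₂∈P , ≋-trans (≋-sym w≋w′) w≋

  InDC? : ∀ n s → Decidable (InDC n s)
  InDC? n s w = Finite.∃? (n ℕ.+ n) resp₁ λ p₁ → Finite.∃? (n ℕ.+ n) (resp₂ p₁) λ p₂ →
                  InP? n p₁ ×-dec InP? n p₂ ×-dec w ≋? (p₁ ⊗ σ n s) ⊗ p₂
    where
      resp₂ : ∀ p₁ → (λ p₂ → InP n p₁ × InP n p₂ × w ≋ ((p₁ ⊗ σ n s) ⊗ p₂)) Respects _≋_
      resp₂ p₁ p₂≋p₂′ (p₁∈P , p₂∈P , w≋) = p₁∈P , InP-resp p₂≋p₂′ p₂∈P , ≋-trans w≋ (⊗-cong (≋-refl {A = p₁ ⊗ σ n s}) p₂≋p₂′)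
      resp₁ : (λ p₁ → ∃ λ p₂ → InP n p₁ × InP n p₂ × w ≋ ((p₁ ⊗ σ n s) ⊗ p₂)) Respects _≋_
      resp₁ p₁≋p₁′ (p₂ , p₁∈P , p₂∈P , w≋) =
        p₂ , InP-resp p₁≋p₁′ p₁∈P , p₂∈P , ≋-trans w≋ (⊗-cong (⊗-cong p₁≋p₁′ (≋-refl {A = σ n s})) (≋-refl {A = p₂}))

  N-DC>0-intro : ∀ {n s β} w → InDC n s w → Tr w ≡ β → N-DC>0 n s β
  N-DC>0-intro {n} {s} {β} w w∈DC Tr≡β = size resp P? , size-positive resp P? (w∈DC , Tr≡β) , hasSize resp P?
    where
      open Finite (n ℕ.+ n)
      resp : (λ w → InDC n s w × Tr w ≡ β) Respects _≋_
      resp w≋w′ (w∈DC , Tr≡β) = InDC-resp w≋w′ w∈DC , trans (sym (Tr-cong w≋w′)) Tr≡β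
      P? : Decidable (λ w → InDC n s w × Tr w ≡ β)
      P? w = InDC? n s w ×-dec Tr w ≟ β

  E< E≥ : ∀ n → ℕ → Mat n n
  E< n s i j = if ⌊ i Fin.≟ j ⌋ ∧ ⌊ toℕ i <? s ⌋ then 1# else 0#
  E≥ n s i j = if ⌊ i Fin.≟ j ⌋ ∧ not ⌊ toℕ i <? s ⌋ then 1# else 0#

  E<-off-diagonal : ∀ {n s} {i j : Fin n} → i ≢ j → E< n s i j ≡ 0#
  E<-off-diagonal {i = i} {j} i≢j with i Fin.≟ j
  ... | yes i≡j = contradiction i≡j i≢j
  ... | no  _   = refl

  σ-block : ∀ n s → σ n s ≋ block (E≥ n s) (E< n s) (E< n s) (E≥ n s)
  σ-block n s = quadrant-ext
    (λ i j → trans (σ₁₁ i j) (sym (block₁₁ _ _ _ _ i j))) (λ i j → trans (σ₁₂ i j) (sym (block₁₂ _ _ _ _ i j)))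
    (λ i j → trans (σ₂₁ i j) (sym (block₂₁ _ _ _ _ i j))) (λ i j → trans (σ₂₂ i j) (sym (block₂₂ _ _ _ _ i j)))
    where
      σ₁₁ : ∀ i j → σ n s (i ↑ˡ n) (j ↑ˡ n) ≡ E≥ n s i j
      σ₁₁ i j rewrite splitAt-↑ˡ n i n | splitAt-↑ˡ n j n = refl
      σ₁₂ : ∀ i j → σ n s (i ↑ˡ n) (n ↑ʳ j) ≡ E< n s i j
      σ₁₂ i j rewrite splitAt-↑ˡ n i n | splitAt-↑ʳ n n j = refl
      σ₂₁ : ∀ i j → σ n s (n ↑ʳ i) (j ↑ˡ n) ≡ E< n s i j
      σ₂₁ i j rewrite splitAt-↑ʳ n n i | splitAt-↑ˡ n j n = refl
      σ₂₂ : ∀ i j → σ n s (n ↑ʳ i) (n ↑ʳ j) ≡ E≥ n s i j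
      σ₂₂ i j rewrite splitAt-↑ʳ n n i | splitAt-↑ʳ n n j = refl

  coset-element : ∀ {n} s (A A′ B : Mat n n) → Mat (n ℕ.+ n) (n ℕ.+ n)
  coset-element {n} s A A′ B = (Pmat (I n) (I n) (O n n) ⊗ σ n s) ⊗ Pmat A A′ B

  coset-element-InDC : ∀ {n} s (A A′ B : Mat n n) → IsInverse A A′ → SymZeroDiag B → InDC n s (coset-element s A A′ B)
  coset-element-InDC {n} s A A′ B inverse symmetric =
    _ , _ , Pmat-InP (⊗-identityˡ (I n) , ⊗-identityˡ (I n)) ((λ _ _ → refl) , (λ _ → refl)) , Pmat-InP inverse symmetric , ≋-refl

  Tr-coset-element : ∀ {n} s (A A′ B : Mat n n) →
    Tr (coset-element s A A′ B) ≡ Tr (E≥ n s ⊗ A) + (Tr (E< n s ⊗ (A ⊗ B)) + Tr (E≥ n s ⊗ transpose A′))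
  Tr-coset-element {n} s A A′ B = begin
    Tr (coset-element s A A′ B)
      ≡⟨ Tr-cong (⊗-cong σ-part (Pmat-block A A′ B)) ⟩
    Tr (block E≥ₛ E<ₛ E<ₛ E≥ₛ ⊗ block A (A ⊗ B) (O n n) (transpose A′))
      ≡⟨ Tr-cong (block-⊗ E≥ₛ E<ₛ E<ₛ E≥ₛ A (A ⊗ B) (O n n) (transpose A′)) ⟩
    Tr (block X₁₁ X₁₂ X₂₁ X₂₂)
      ≡⟨ Tr-block X₁₁ X₁₂ X₂₁ X₂₂ ⟩
    Tr X₁₁ + Tr X₂₂
      ≡⟨ cong₂ _+_ (trans (Tr-⊞ (E≥ₛ ⊗ A) (E<ₛ ⊗ O n n)) (cong (Tr (E≥ₛ ⊗ A) +_) Tr-E<⊗O≡0))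
                   (Tr-⊞ (E<ₛ ⊗ (A ⊗ B)) (E≥ₛ ⊗ transpose A′)) ⟩
    Tr (E≥ₛ ⊗ A) + 0# + (Tr (E<ₛ ⊗ (A ⊗ B)) + Tr (E≥ₛ ⊗ transpose A′))
      ≡⟨ cong (_+ (Tr (E<ₛ ⊗ (A ⊗ B)) + Tr (E≥ₛ ⊗ transpose A′))) (+-identityʳ _) ⟩
    Tr (E≥ₛ ⊗ A) + (Tr (E<ₛ ⊗ (A ⊗ B)) + Tr (E≥ₛ ⊗ transpose A′)) ∎
    where
      E<ₛ E≥ₛ X₁₁ X₁₂ X₂₁ X₂₂ : Mat n n
      E<ₛ = E< n s
      E≥ₛ = E≥ n s
      X₁₁ = (E≥ₛ ⊗ A) ⊞ (E<ₛ ⊗ O n n)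
      X₁₂ = (E≥ₛ ⊗ (A ⊗ B)) ⊞ (E<ₛ ⊗ transpose A′)
      X₂₁ = (E<ₛ ⊗ A) ⊞ (E≥ₛ ⊗ O n n)
      X₂₂ = (E<ₛ ⊗ (A ⊗ B)) ⊞ (E≥ₛ ⊗ transpose A′)
      σ-part : (Pmat (I n) (I n) (O n n) ⊗ σ n s) ≋ block E≥ₛ E<ₛ E<ₛ E≥ₛ
      σ-part = ≋-trans (⊗-cong (Pmat-identity {n}) (σ-block n s)) (block-identityˡ E≥ₛ E<ₛ E<ₛ E≥ₛ)
      Tr-E<⊗O≡0 : Tr (E<ₛ ⊗ O n n) ≡ 0#
      Tr-E<⊗O≡0 = trans (Tr-cong (⊗-zeroʳ E<ₛ)) (Tr-O n)

  E≥-0 : ∀ {n} → E≥ n 0 ≋ I n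
  E≥-0 i j with i Fin.≟ j
  ... | yes _ = refl
  ... | no  _ = refl

  E<-0 : ∀ {n} → E< n 0 ≋ O n n
  E<-0 i j with i Fin.≟ j
  ... | yes _ = refl
  ... | no  _ = refl

  block-diagonal-⊗ : ∀ {n} (A D A′ D′ : Mat n n) →
    (block A (O n n) (O n n) D ⊗ block A′ (O n n) (O n n) D′) ≋ block (A ⊗ A′) (O n n) (O n n) (D ⊗ D′)
  block-diagonal-⊗ {n} A D A′ D′ = ≋-trans (block-⊗ A (O n n) (O n n) D A′ (O n n) (O n n) D′) (block-cong
    (λ i j → trans (cong ((A ⊗ A′) i j +_) (⊗-zeroˡ (O n n) i j)) (+-identityʳ _))
    (λ i j → trans (cong₂ _+_ (⊗-zeroʳ A i j) (⊗-zeroˡ D′ i j)) (+-identityʳ _))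
    (λ i j → trans (cong₂ _+_ (⊗-zeroˡ A′ i j) (⊗-zeroʳ D i j)) (+-identityʳ _))
    (λ i j → trans (cong (_+ (D ⊗ D′) i j) (⊗-zeroˡ (O n n) i j)) (+-identityˡ _)))

  σ-0 : ∀ n → σ n 0 ≋ block (I n) (O n n) (O n n) (I n)
  σ-0 n = ≋-trans (σ-block n 0) (block-cong (E≥-0 {n}) (E<-0 {n}) (E<-0 {n}) (E≥-0 {n}))

  coset-element-0 : ∀ {n} (A A′ B : Mat n n) → coset-element 0 A A′ B ≋ block A (A ⊗ B) (O n n) (transpose A′)
  coset-element-0 {n} A A′ B =
    ≋-trans (⊗-cong σ-part (Pmat-block A A′ B)) (block-identityˡ A (A ⊗ B) (O n n) (transpose A′))
    where
      σ-part : (Pmat (I n) (I n) (O n n) ⊗ σ n 0) ≋ block (I n) (O n n) (O n n) (I n)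
      σ-part = ≋-trans (⊗-cong (Pmat-identity {n}) (σ-0 n)) (block-identityˡ (I n) (O n n) (O n n) (I n))

  Tr-coset-element-0 : ∀ {n} (A A′ B : Mat n n) → Tr (coset-element 0 A A′ B) ≡ Tr A + Tr A′
  Tr-coset-element-0 {n} A A′ B = trans (Tr-cong (coset-element-0 A A′ B)) (Tr-block A (A ⊗ B) (O n n) (transpose A′))

module LargeDoubleCosets (F : FiniteField2) where
  open DoubleCosets F

  module _ (m : ℕ) where
    private
      n : ℕ
      n = suc (suc m)

      e₀₁ : Mat n n
      e₀₁ zero (suc zero) = 1#
      e₀₁ _    _          = 0#

      e₀₁⊗e₀₁≋O : (e₀₁ ⊗ e₀₁) ≋ O n n
      e₀₁⊗e₀₁≋O i j = ∑-zero _ (λ l → vanishing i l j)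
        where
          vanishing : ∀ i l j → e₀₁ i l * e₀₁ l j ≡ 0#
          vanishing zero    zero          j = zeroˡ _
          vanishing (suc i) zero          j = zeroˡ _
          vanishing i       (suc zero)    j = zeroʳ _
          vanishing zero    (suc (suc l)) j = zeroˡ _
          vanishing (suc i) (suc (suc l)) j = zeroˡ _

      A : Mat n n
      A = I n ⊞ e₀₁

      A⊗A≋I : (A ⊗ A) ≋ I n
      A⊗A≋I i j = begin
        (A ⊗ A) i j                                         ≡⟨ ⊗-distribʳ-⊞ A (I n) e₀₁ i j ⟩
        (I n ⊗ A) i j + (e₀₁ ⊗ A) i j                       ≡⟨ cong₂ _+_ (⊗-identityˡ A i j) (⊗-distribˡ-⊞ e₀₁ (I n) e₀₁ i j) ⟩
        I n i j + e₀₁ i j + ((e₀₁ ⊗ I n) i j + (e₀₁ ⊗ e₀₁) i j) ≡⟨ cong (I n i j + e₀₁ i j +_) (cong₂ _+_ (⊗-identityʳ e₀₁ i j) (e₀₁⊗e₀₁≋O i j)) ⟩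
        I n i j + e₀₁ i j + (e₀₁ i j + 0#)                  ≡⟨ solve 3 (λ x e z → x ⊕ e ⊕ (e ⊕ z) ⊜ (x ⊕ (e ⊕ e) ⊕ z)) refl (I n i j) (e₀₁ i j) 0# ⟩
        I n i j + (e₀₁ i j + e₀₁ i j) + 0#                  ≡⟨ trans (+-identityʳ _) (cong (I n i j +_) (x+x≡0 (e₀₁ i j))) ⟩
        I n i j + 0#                                        ≡⟨ +-identityʳ _ ⟩
        I n i j                                             ∎

      B : Carrier → Mat n n
      B b zero       (suc zero) = b
      B b (suc zero) zero       = b
      B b _          _          = 0#

      B-SymZeroDiag : ∀ b → SymZeroDiag (B b)
      B-SymZeroDiag b = symmetric , zero-diagonal
        where
          symmetric : ∀ i j → B b i j ≡ B b j i
          symmetric zero             zero             = refl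
          symmetric zero             (suc zero)       = refl
          symmetric zero             (suc (suc j))    = refl
          symmetric (suc zero)       zero             = refl
          symmetric (suc zero)       (suc zero)       = refl
          symmetric (suc zero)       (suc (suc j))    = refl
          symmetric (suc (suc i))    zero             = refl
          symmetric (suc (suc i))    (suc zero)       = refl
          symmetric (suc (suc i))    (suc (suc j))    = refl
          zero-diagonal : ∀ i → B b i i ≡ 0#
          zero-diagonal zero          = refl
          zero-diagonal (suc zero)    = refl
          zero-diagonal (suc (suc i)) = refl

      A⊗B-00 : ∀ b → (A ⊗ B b) zero zero ≡ b
      A⊗B-00 b = trans (∑-single _ (suc zero) vanishing) (trans (cong (_* b) (+-identityˡ 1#)) (*-identityˡ b))
        where
          vanishing : ∀ l → l ≢ suc zero → A zero l * B b l zero ≡ 0#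
          vanishing zero          _ = zeroʳ _
          vanishing (suc zero)    l≢1 = contradiction refl l≢1
          vanishing (suc (suc l)) _ = zeroʳ _

      A⊗B-diagonal-suc : ∀ b k → (A ⊗ B b) (suc k) (suc k) ≡ 0#
      A⊗B-diagonal-suc b k = ∑-zero _ (vanishing k)
        where
          vanishing : ∀ k l → A (suc k) l * B b l (suc k) ≡ 0#
          vanishing zero    zero          = trans (cong (_* b) (+-identityˡ 0#)) (zeroˡ b)
          vanishing zero    (suc zero)    = zeroʳ _
          vanishing zero    (suc (suc l)) = zeroʳ _
          vanishing (suc k) zero          = zeroʳ _
          vanishing (suc k) (suc zero)    = zeroʳ _
          vanishing (suc k) (suc (suc l)) = zeroʳ _

      Tr-E<⊗A⊗B : ∀ s′ b → Tr (E< n (suc s′) ⊗ (A ⊗ B b)) ≡ b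
      Tr-E<⊗A⊗B s′ b = begin
        Tr (E< n (suc s′) ⊗ (A ⊗ B b))                          ≡⟨ Tr-⊗-diagonalˡ (E< n (suc s′)) (A ⊗ B b) E<-off-diagonal ⟩
        ∑ (λ i → E< n (suc s′) i i * (A ⊗ B b) i i)             ≡⟨ ∑-single _ zero vanishing ⟩
        1# * (A ⊗ B b) zero zero                                ≡⟨ trans (*-identityˡ _) (A⊗B-00 b) ⟩
        b                                                       ∎
        where
          vanishing : ∀ i → i ≢ zero → E< n (suc s′) i i * (A ⊗ B b) i i ≡ 0#
          vanishing zero    i≢0 = contradiction refl i≢0
          vanishing (suc k) _   = trans (cong (E< n (suc s′) (suc k) (suc k) *_) (A⊗B-diagonal-suc b k)) (zeroʳ _)

    N-DC>0-large : ∀ s′ β → N-DC>0 n (suc s′) β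
    N-DC>0-large s′ β = N-DC>0-intro w (coset-element-InDC (suc s′) A A (B b) (A⊗A≋I , A⊗A≋I) (B-SymZeroDiag b)) (begin
        Tr w                  ≡⟨ Tr-coset-element (suc s′) A A (B b) ⟩
        c₁ + (Tr (E< n (suc s′) ⊗ (A ⊗ B b)) + c₂)      ≡⟨ cong (λ t → c₁ + (t + c₂)) (Tr-E<⊗A⊗B s′ b) ⟩
        c₁ + (β + (c₁ + c₂) + c₂)                           ≡⟨ solve 3 (λ β c₁ c₂ → c₁ ⊕ (β ⊕ (c₁ ⊕ c₂) ⊕ c₂) ⊜ (β ⊕ ((c₁ ⊕ c₁) ⊕ (c₂ ⊕ c₂)))) refl β c₁ c₂ ⟩
        β + ((c₁ + c₁) + (c₂ + c₂))                         ≡⟨ cong (β +_) (trans (cong₂ _+_ (x+x≡0 c₁) (x+x≡0 c₂)) (+-identityˡ 0#)) ⟩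
        β + 0#                                              ≡⟨ +-identityʳ β ⟩
        β                                                   ∎)
      where
        c₁ c₂ b : Carrier
        c₁ = Tr (E≥ n (suc s′) ⊗ A)
        c₂ = Tr (E≥ n (suc s′) ⊗ transpose A)
        b = β + (c₁ + c₂)
        w = coset-element (suc s′) A A (B b)

module SmallDoubleCoset (F : FiniteField2) where
  open DoubleCosets F

  ∃≢0∧≢1 : 2 ≤ r → Σ Carrier λ d → d ≢ 0# × d ≢ 1#
  ∃≢0∧≢1 2≤r = choose (distinct {zero} {suc zero} (λ ())) (distinct {zero} {suc (suc zero)} (λ ()))
                       (distinct {suc zero} {suc (suc zero)} (λ ()))
    where
      4≤q : 4 ≤ q
      4≤q = ^-monoʳ-≤ 2 2≤r
      x : Fin 4 → Carrier
      x k = element (inject≤ k 4≤q)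
      distinct : ∀ {j k} → j ≢ k → x j ≢ x k
      distinct j≢k e = j≢k (inject≤-injective 4≤q 4≤q _ _ (element-injective e))
      choose : ∀ {a b c} → a ≢ b → a ≢ c → b ≢ c → Σ Carrier λ d → d ≢ 0# × d ≢ 1#
      choose {a} {b} {c} a≢b a≢c b≢c with a ≟ 0# | a ≟ 1# | b ≟ 0# | b ≟ 1#
      ... | no a≢0  | no a≢1  | _       | _       = a , a≢0 , a≢1
      ... | _       | _       | no b≢0  | no b≢1  = b , b≢0 , b≢1
      ... | yes a≡0 | _       | yes b≡0 | _       = contradiction (trans a≡0 (sym b≡0)) a≢b
      ... | yes a≡0 | _       | no _    | yes b≡1 = c , (λ c≡0 → a≢c (trans a≡0 (sym c≡0))) , (λ c≡1 → b≢c (trans b≡1 (sym c≡1)))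
      ... | no _    | yes a≡1 | yes b≡0 | _       = c , (λ c≡0 → b≢c (trans b≡0 (sym c≡0))) , (λ c≡1 → a≢c (trans a≡1 (sym c≡1)))
      ... | no _    | yes a≡1 | no _    | yes b≡1 = contradiction (trans a≡1 (sym b≡1)) a≢b

  module _ {d : Carrier} (d≢0 : d ≢ 0#) (t : Carrier) where
    private
      e : Carrier
      e = inv d

      d*e≡1 : d * e ≡ 1#
      d*e≡1 = inv-law d d≢0

    companion companion⁻¹ : Mat 2 2
    companion   = mat₂ 0# 1# d t
    companion⁻¹ = mat₂ (t * e) e 1# 0#

    companion-inverse : IsInverse companion companion⁻¹
    companion-inverse =
      ≋-trans (mat₂-⊗ 0# 1# d t (t * e) e 1# 0#) (≋-trans (mat₂-cong
        (trans (cong₂ _+_ (zeroˡ _) (*-identityˡ 1#)) (+-identityˡ 1#))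
        (trans (cong₂ _+_ (zeroˡ e) (zeroʳ 1#)) (+-identityˡ 0#))
        (trans (cong₂ _+_ d*te≡t (*-identityʳ t)) (x+x≡0 t))
        (trans (cong₂ _+_ d*e≡1 (zeroʳ t)) (+-identityʳ 1#))) mat₂-I) ,
      ≋-trans (mat₂-⊗ (t * e) e 1# 0# 0# 1# d t) (≋-trans (mat₂-cong
        (trans (cong₂ _+_ (zeroʳ (t * e)) (trans (*-comm e d) d*e≡1)) (+-identityˡ 1#))
        (trans (cong₂ _+_ (*-identityʳ (t * e)) (*-comm e t)) (x+x≡0 (t * e)))
        (trans (cong₂ _+_ (zeroʳ 1#) (zeroˡ d)) (+-identityˡ 0#))
        (trans (cong₂ _+_ (*-identityˡ 1#) (zeroˡ t)) (+-identityʳ 1#))) mat₂-I)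
      where
        d*te≡t : d * (t * e) ≡ t
        d*te≡t = trans (solve 3 (λ d t e → d ⊛ (t ⊛ e) ⊜ (t ⊛ (d ⊛ e))) refl d t e)
                       (trans (cong (t *_) d*e≡1) (*-identityʳ t))

    Tr-companion : Tr companion + Tr companion⁻¹ ≡ t * (1# + e)
    Tr-companion = begin
      (0# + (t + 0#)) + (t * e + (0# + 0#))    ≡⟨ cong₂ _+_ (trans (+-identityˡ _) (+-identityʳ t)) (cong (t * e +_) (+-identityˡ 0#)) ⟩
      t + (t * e + 0#)                         ≡⟨ cong (t +_) (+-identityʳ (t * e)) ⟩
      t + t * e                                ≡⟨ cong (_+ t * e) (sym (*-identityʳ t)) ⟩
      t * 1# + t * e                           ≡⟨ distribˡ t 1# e ⟨
      t * (1# + e)                             ∎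

  -- The companion matrix of x² + t x + d has trace t and its inverse trace t / d;
  -- d ∉ {0, 1} makes t ↦ t (1 + 1 / d) surjective.
  N-DC>0-2-0 : 2 ≤ r → ∀ β → N-DC>0 2 0 β
  N-DC>0-2-0 2≤r β with d , d≢0 , d≢1 ← ∃≢0∧≢1 2≤r =
    N-DC>0-intro {s = 0} (coset-element 0 (companion d≢0 t) (companion⁻¹ d≢0 t) (O 2 2))
      (coset-element-InDC 0 (companion d≢0 t) (companion⁻¹ d≢0 t) (O 2 2) (companion-inverse d≢0 t) ((λ _ _ → refl) , (λ _ → refl))) (begin
        Tr (coset-element 0 (companion d≢0 t) (companion⁻¹ d≢0 t) (O 2 2))
          ≡⟨ Tr-coset-element-0 (companion d≢0 t) (companion⁻¹ d≢0 t) (O 2 2) ⟩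
        Tr (companion d≢0 t) + Tr (companion⁻¹ d≢0 t)                       ≡⟨ Tr-companion d≢0 t ⟩
        β * inv c * c                                                       ≡⟨ *-assoc β (inv c) c ⟩
        β * (inv c * c)                                                     ≡⟨ cong (β *_) (trans (*-comm (inv c) c) (inv-law c c≢0)) ⟩
        β * 1#                                                              ≡⟨ *-identityʳ β ⟩
        β                                                                   ∎)
    where
      c t : Carrier
      c = 1# + inv d
      t = β * inv c
      c≢0 : c ≢ 0#
      c≢0 c≡0 = d≢1 (begin
        d                     ≡⟨ *-identityʳ d ⟨
        d * 1#                ≡⟨ cong (d *_) (x+y≡0⇒y≡x c≡0) ⟨
        d * inv d             ≡⟨ inv-law d d≢0 ⟩
        1#                    ∎)

module DimensionOne (F : FiniteField2) where
  open DoubleCosets F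

  scalar : Carrier → Mat 1 1
  scalar u _ _ = u

  1×1-ext : ∀ {A B : Mat 1 1} → A zero zero ≡ B zero zero → A ≋ B
  1×1-ext e zero zero = e

  diag : Carrier → Carrier → Mat 2 2
  diag u v = block (scalar u) (O 1 1) (O 1 1) (scalar v)

  diag-cong : ∀ {u v u′ v′} → u ≡ u′ → v ≡ v′ → diag u v ≋ diag u′ v′
  diag-cong refl refl = ≋-refl

  Tr-diag : ∀ u v → Tr (diag u v) ≡ u + v
  Tr-diag u v = trans (Tr-block (scalar u) (O 1 1) (O 1 1) (scalar v)) (cong₂ _+_ (+-identityʳ u) (+-identityʳ v))

  O-SymZeroDiag : SymZeroDiag (O 1 1)
  O-SymZeroDiag = (λ _ _ → refl) , (λ _ → refl)

  diag-InDC : ∀ {u v} → u * v ≡ 1# → InDC 1 0 (diag u v)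
  diag-InDC {u} {v} uv≡1 = InDC-resp {s = 0} (≋-trans (coset-element-0 (scalar u) (scalar v) (O 1 1))
      (block-cong (≋-refl {A = scalar u}) (⊗-zeroʳ (scalar u)) (≋-refl {A = O 1 1}) (≋-refl {A = scalar v})))
    (coset-element-InDC 0 (scalar u) (scalar v) (O 1 1) (1×1-ext (trans (+-identityʳ _) uv≡1) ,
                                               1×1-ext (trans (+-identityʳ _) (trans (*-comm v u) uv≡1))) O-SymZeroDiag)

  -- B is 1 × 1 with zero diagonal, so Pmat A A′ B is diagonal, and so is σ₀ = 1.
  InDC⇒diag : ∀ {w} → InDC 1 0 w → Σ Carrier λ u → Σ Carrier λ v → u * v ≡ 1# × w ≋ diag u v
  InDC⇒diag {w} (p₁ , p₂ , (A₁ , A₁′ , B₁ , A₁-inverse , (_ , B₁-diagonal) , p₁≋) , (A₂ , A₂′ , B₂ , A₂-inverse , (_ , B₂-diagonal) , p₂≋) , w≋) =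
    a₁ * a₂ , a₁′ * a₂′ , uv≡1 , (≋-begin
      w                                                         ≈⟨ w≋ ⟩
      (p₁ ⊗ σ 1 0) ⊗ p₂                                         ≈⟨ ⊗-cong (⊗-cong (≋-trans p₁≋ (Pmat-diagonal (B₁-diagonal zero))) (σ-0 1)) (≋-trans p₂≋ (Pmat-diagonal (B₂-diagonal zero))) ⟩
      (block A₁ (O 1 1) (O 1 1) (transpose A₁′) ⊗ block (I 1) (O 1 1) (O 1 1) (I 1)) ⊗ block A₂ (O 1 1) (O 1 1) (transpose A₂′)
        ≈⟨ ⊗-cong (≋-trans (block-diagonal-⊗ A₁ (transpose A₁′) (I 1) (I 1))
                          (block-cong (⊗-identityʳ A₁) ≋-refl ≋-refl (⊗-identityʳ (transpose A₁′))))
                  (≋-refl {A = block A₂ (O 1 1) (O 1 1) (transpose A₂′)}) ⟩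
      block A₁ (O 1 1) (O 1 1) (transpose A₁′) ⊗ block A₂ (O 1 1) (O 1 1) (transpose A₂′)
        ≈⟨ block-diagonal-⊗ A₁ (transpose A₁′) A₂ (transpose A₂′) ⟩
      block (A₁ ⊗ A₂) (O 1 1) (O 1 1) (transpose A₁′ ⊗ transpose A₂′)
        ≈⟨ block-cong (1×1-ext (+-identityʳ _)) ≋-refl ≋-refl (1×1-ext (+-identityʳ _)) ⟩
      diag (a₁ * a₂) (a₁′ * a₂′)                                ≋∎)
    where
      open import Relation.Binary.Reasoning.Setoid (DecSetoid.setoid (matrixDecSetoid 2))
        using (step-≈-⟩) renaming (begin_ to ≋-begin_; _∎ to _≋∎)
      a₁ a₁′ a₂ a₂′ : Carrier
      a₁  = A₁ zero zero
      a₁′ = A₁′ zero zero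
      a₂  = A₂ zero zero
      a₂′ = A₂′ zero zero
      Pmat-diagonal : ∀ {A A′ B : Mat 1 1} → B zero zero ≡ 0# → Pmat A A′ B ≋ block A (O 1 1) (O 1 1) (transpose A′)
      Pmat-diagonal {A} {A′} {B} b≡0 = ≋-trans (Pmat-block A A′ B)
        (block-cong ≋-refl (1×1-ext (trans (+-identityʳ _) (trans (cong (A zero zero *_) b≡0) (zeroʳ _)))) ≋-refl ≋-refl)
      uv≡1 : a₁ * a₂ * (a₁′ * a₂′) ≡ 1#
      uv≡1 = begin
        a₁ * a₂ * (a₁′ * a₂′)          ≡⟨ solve 4 (λ a b c d → (a ⊛ b) ⊛ (c ⊛ d) ⊜ ((a ⊛ c) ⊛ (b ⊛ d))) refl a₁ a₂ a₁′ a₂′ ⟩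
        a₁ * a₁′ * (a₂ * a₂′)          ≡⟨ cong₂ _*_ (trans (sym (+-identityʳ _)) (proj₁ A₁-inverse zero zero)) (trans (sym (+-identityʳ _)) (proj₁ A₂-inverse zero zero)) ⟩
        1# * 1#                        ≡⟨ *-identityˡ 1# ⟩
        1#                             ∎

  InDC∧Tr⇒diag : ∀ {w β} → InDC 1 0 w → Tr w ≡ β → Σ Carrier λ u → u * (u + β) ≡ 1# × w ≋ diag u (u + β)
  InDC∧Tr⇒diag {w} {β} w∈DC Tr≡β with u , v , uv≡1 , w≋ ← InDC⇒diag w∈DC =
    u , trans (cong (u *_) (sym v≡u+β)) uv≡1 , ≋-trans w≋ (diag-cong refl v≡u+β)
    where
      v≡u+β : v ≡ u + β
      v≡u+β = begin
        v              ≡⟨ +-identityˡ v ⟨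
        0# + v         ≡⟨ cong (_+ v) (x+x≡0 u) ⟨
        u + u + v      ≡⟨ +-assoc u u v ⟩
        u + (u + v)    ≡⟨ cong (u +_) (trans (sym (Tr-diag u v)) (trans (sym (Tr-cong w≋)) Tr≡β)) ⟩
        u + β          ∎

  N-DC≡-1-0-0 : N-DC≡ 1 0 0# 1
  N-DC≡-1-0-0 = (λ _ → diag 1# 1#) , (λ _ → diag-InDC (*-identityˡ 1#) , trans (Tr-diag 1# 1#) 1+1≡0) ,
                (λ { zero zero _ → refl }) , covering
    where
      covering : ∀ w → InDC 1 0 w × Tr w ≡ 0# → ∃ λ i → w ≋ diag 1# 1#
      covering w (w∈DC , Tr≡0) with u , u[u+0]≡1 , w≋ ← InDC∧Tr⇒diag w∈DC Tr≡0 =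
        zero , ≋-trans w≋ (diag-cong u≡1 (trans (+-identityʳ u) u≡1))
        where
          u≡1 : u ≡ 1#
          u≡1 = sym (x+y≡0⇒y≡x (sq≡0⇒≡0 (begin
            sq (u + 1#)              ≡⟨ sq-+ u 1# ⟩
            sq u + sq 1#             ≡⟨ cong₂ _+_ (trans (cong (u *_) (sym (+-identityʳ u))) u[u+0]≡1) (*-identityˡ 1#) ⟩
            1# + 1#                  ≡⟨ 1+1≡0 ⟩
            0#                       ∎)))

  +β-solves : ∀ {a β} → a * (a + β) ≡ 1# → (a + β) * (a + β + β) ≡ 1#
  +β-solves {a} {β} a-solves = begin
    (a + β) * (a + β + β)      ≡⟨ cong ((a + β) *_) (trans (+-assoc a β β) (trans (cong (a +_) (x+x≡0 β)) (+-identityʳ a))) ⟩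
    (a + β) * a                ≡⟨ *-comm (a + β) a ⟩
    a * (a + β)                ≡⟨ a-solves ⟩
    1#                         ∎

  -- (u + a) (u + a + β) = u (u + β) + a (a + β) + 2 u a = 1 + 1 = 0.
  solutions-dichotomy : ∀ {u a β} → u * (u + β) ≡ 1# → a * (a + β) ≡ 1# → u ≡ a ⊎ u ≡ a + β
  solutions-dichotomy {u} {a} {β} u-solves a-solves with u + a ≟ 0#
  ... | yes u+a≡0 = inj₁ (x+y≡0⇒y≡x (trans (+-comm a u) u+a≡0))
  ... | no  u+a≢0 = inj₂ (x+y≡0⇒y≡x (trans (+-comm (a + β) u) (trans (sym (+-assoc u a β)) (x*y≡0⇒y≡0 u+a≢0 product≡0))))
    where
      product≡0 : (u + a) * (u + a + β) ≡ 0#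
      product≡0 = begin
        (u + a) * (u + a + β)                         ≡⟨ solve 3 (λ u a b → (u ⊕ a) ⊛ (u ⊕ a ⊕ b) ⊜ ((u ⊛ (u ⊕ b) ⊕ a ⊛ (a ⊕ b)) ⊕ (u ⊛ a ⊕ u ⊛ a))) refl u a β ⟩
        (u * (u + β) + a * (a + β)) + (u * a + u * a) ≡⟨ cong₂ _+_ (cong₂ _+_ u-solves a-solves) (x+x≡0 (u * a)) ⟩
        1# + 1# + 0#                                  ≡⟨ trans (+-identityʳ _) 1+1≡0 ⟩
        0#                                            ∎

  module _ {β} (β≢0 : β ≢ 0#) where
    private
      β⁻¹ : Carrier
      β⁻¹ = inv β

      β*β⁻¹≡1 : β * β⁻¹ ≡ 1#
      β*β⁻¹≡1 = inv-law β β≢0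

    artin-schreier : ∀ u → u * (u + β) ≡ 1# → sq (u * β⁻¹) + u * β⁻¹ ≡ sq β⁻¹
    artin-schreier u u[u+β]≡1 = begin
      sq (u * β⁻¹) + u * β⁻¹                      ≡⟨ cong (sq (u * β⁻¹) +_) (trans (sym (*-identityʳ _)) (cong (u * β⁻¹ *_) (sym β*β⁻¹≡1))) ⟩
      sq (u * β⁻¹) + u * β⁻¹ * (β * β⁻¹)          ≡⟨ solve 3 (λ u i b → (u ⊛ i) ⊛ (u ⊛ i) ⊕ (u ⊛ i) ⊛ (b ⊛ i) ⊜ ((u ⊛ (u ⊕ b)) ⊛ (i ⊛ i))) refl u β⁻¹ β ⟩
      u * (u + β) * sq β⁻¹                        ≡⟨ cong (_* sq β⁻¹) u[u+β]≡1 ⟩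
      1# * sq β⁻¹                                 ≡⟨ *-identityˡ _ ⟩
      sq β⁻¹                                      ∎

    N-DC≡-1-0-tr1 : tr β⁻¹ ≡ 1# → N-DC≡ 1 0 β 0
    N-DC≡-1-0-tr1 tr≡1 = (λ ()) , (λ ()) , (λ ()) , λ w (w∈DC , Tr≡β) →
      let u , u[u+β]≡1 , _ = InDC∧Tr⇒diag w∈DC Tr≡β in
      contradiction (begin
        0#                                ≡⟨ tr-sq+id (u * β⁻¹) ⟨
        tr (sq (u * β⁻¹) + u * β⁻¹)       ≡⟨ cong tr (artin-schreier u u[u+β]≡1) ⟩
        tr (sq β⁻¹)                       ≡⟨ tr-sq β⁻¹ ⟩
        tr β⁻¹                            ≡⟨ tr≡1 ⟩
        1#                                ∎) 0≢1

    sq+id≡β⁻²⇒solves : ∀ y → sq y + y ≡ sq β⁻¹ → β * y * (β * y + β) ≡ 1#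
    sq+id≡β⁻²⇒solves y sq-y+y = begin
      β * y * (β * y + β)            ≡⟨ solve 2 (λ b y → (b ⊛ y) ⊛ (b ⊛ y ⊕ b) ⊜ ((b ⊛ b) ⊛ (y ⊛ y ⊕ y))) refl β y ⟩
      sq β * (sq y + y)              ≡⟨ cong (sq β *_) sq-y+y ⟩
      sq β * sq β⁻¹                  ≡⟨ sq-* β β⁻¹ ⟨
      sq (β * β⁻¹)                   ≡⟨ cong sq β*β⁻¹≡1 ⟩
      sq 1#                          ≡⟨ *-identityˡ 1# ⟩
      1#                             ∎

    N-DC≡-1-0-solvable : ∀ {a} → a * (a + β) ≡ 1# → N-DC≡ 1 0 β 2
    N-DC≡-1-0-solvable {a} a-solves = solution , (λ i → diag-InDC (solves i) , Tr-solution i) , injective , covering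
      where
        root : Fin 2 → Carrier
        root zero       = a
        root (suc zero) = a + β

        solution : Fin 2 → Mat 2 2
        solution i = diag (root i) (root i + β)

        solves : ∀ i → root i * (root i + β) ≡ 1#
        solves zero       = a-solves
        solves (suc zero) = +β-solves a-solves

        Tr-solution : ∀ i → Tr (solution i) ≡ β
        Tr-solution i = trans (Tr-diag (root i) (root i + β))
          (trans (sym (+-assoc (root i) (root i) β)) (trans (cong (_+ β) (x+x≡0 (root i))) (+-identityˡ β)))

        injective : ∀ i j → solution i ≋ solution j → i ≡ j
        injective zero       zero       _ = refl
        injective zero       (suc zero) e = contradiction (x+y≡x⇒y≡0 (sym (e zero zero))) β≢0
        injective (suc zero) zero       e = contradiction (x+y≡x⇒y≡0 (e zero zero)) β≢0
        injective (suc zero) (suc zero) _ = refl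

        covering : ∀ w → InDC 1 0 w × Tr w ≡ β → ∃ λ i → w ≋ solution i
        covering w (w∈DC , Tr≡β) with InDC∧Tr⇒diag w∈DC Tr≡β
        ... | u , u-solves , w≋ with solutions-dichotomy u-solves a-solves
        ...   | inj₁ u≡a   = zero , ≋-trans w≋ (diag-cong u≡a (cong (_+ β) u≡a))
        ...   | inj₂ u≡a+β = suc zero , ≋-trans w≋ (diag-cong u≡a+β (cong (_+ β) u≡a+β))

    N-DC≡-1-0-tr0 : tr β⁻¹ ≡ 0# → N-DC≡ 1 0 β 2
    N-DC≡-1-0-tr0 tr≡0 with y , sq-y+y ← tr≡0⇒sq+id-surjective (trans (tr-sq β⁻¹) tr≡0) =
      N-DC≡-1-0-solvable (sq+id≡β⁻²⇒solves y sq-y+y)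

module BinaryField where
  open CommutativeRing xor-∧-commutativeRing using (isCommutativeRing)

  F₂ : FiniteField2
  F₂ = record
    { Carrier = Bool ; _+_ = _xor_ ; _*_ = _∧_ ; -_ = id ; 0# = false ; 1# = true ; inv = id
    ; isCommutativeRing = isCommutativeRing
    ; 0≢1 = λ ()
    ; inv-law = λ { false false≢0 → contradiction refl false≢0 ; true _ → refl }
    ; r = 1
    ; enum = 2↔Bool
    }

  open DoubleCosets F₂ public

  GL₂ GL₂⁻¹ : Fin 6 → Mat 2 2
  GL₂ = Vector.fromList (mat₂ true false false true ∷ mat₂ false true true false ∷ mat₂ true true false true ∷
                         mat₂ true false true true ∷ mat₂ false true true true ∷ mat₂ true true true false ∷ [])
  GL₂⁻¹ = Vector.fromList (mat₂ true false false true ∷ mat₂ false true true false ∷ mat₂ true true false true ∷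
                           mat₂ true false true true ∷ mat₂ true true true false ∷ mat₂ false true true true ∷ [])

  SZD₂ : Fin 2 → Mat 2 2
  SZD₂ b = mat₂ false (toBool b) (toBool b) false
    where toBool = Inverse.to 2↔Bool

  P₂ : Fin 12 → Mat 4 4
  P₂ i = Pmat (GL₂ (proj₁ ab)) (GL₂⁻¹ (proj₁ ab)) (SZD₂ (proj₂ ab))
    where ab = Fin.remQuot {6} 2 i

  private
    ∀-Bool? : {P : Bool → Set} → Decidable P → Dec (∀ b → P b)
    ∀-Bool? P? with P? false | P? true
    ... | yes p-false | yes p-true = yes λ { false → p-false ; true → p-true }
    ... | no ¬p-false | _          = no λ p → ¬p-false (p false)
    ... | _           | no ¬p-true = no λ p → ¬p-true (p true)

  abstract
    GL₂-inverse : ∀ a → IsInverse (GL₂ a) (GL₂⁻¹ a)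
    GL₂-inverse = toWitness {a? = all? λ a → IsInverse? (GL₂ a) (GL₂⁻¹ a)} tt

    SZD₂-SymZeroDiag : ∀ b → SymZeroDiag (SZD₂ b)
    SZD₂-SymZeroDiag = toWitness {a? = all? λ b → SymZeroDiag? (SZD₂ b)} tt

    P₂-injective : ∀ i j → P₂ i ≋ P₂ j → i ≡ j
    P₂-injective = toWitness {a? = all? λ i → all? λ j → P₂ i ≋? P₂ j →-dec i Fin.≟ j} tt

    Tr-P₂ : ∀ i → Tr (P₂ i) ≡ false
    Tr-P₂ = toWitness {a? = all? λ i → Tr (P₂ i) ≟ false} tt

    P₂-closed : ∀ i j → ∃ λ k → (P₂ i ⊗ P₂ j) ≋ P₂ k
    P₂-closed = toWitness {a? = all? λ i → all? λ j → any? λ k → (P₂ i ⊗ P₂ j) ≋? P₂ k} tt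

    P₂-complete-mat₂ : ∀ a b c d a′ b′ c′ d′ e f g h → IsInverse (mat₂ a b c d) (mat₂ a′ b′ c′ d′) →
      SymZeroDiag (mat₂ e f g h) → ∃ λ i → Pmat (mat₂ a b c d) (mat₂ a′ b′ c′ d′) (mat₂ e f g h) ≋ P₂ i
    P₂-complete-mat₂ = toWitness {a? =
      ∀-Bool? λ a → ∀-Bool? λ b → ∀-Bool? λ c → ∀-Bool? λ d → ∀-Bool? λ a′ → ∀-Bool? λ b′ → ∀-Bool? λ c′ → ∀-Bool? λ d′ →
      ∀-Bool? λ e → ∀-Bool? λ f → ∀-Bool? λ g → ∀-Bool? λ h →
      IsInverse? (mat₂ a b c d) (mat₂ a′ b′ c′ d′) →-dec SymZeroDiag? (mat₂ e f g h) →-dec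
      any? λ i → Pmat (mat₂ a b c d) (mat₂ a′ b′ c′ d′) (mat₂ e f g h) ≋? P₂ i} tt

  P₂-complete : ∀ {A A′ B} → IsInverse A A′ → SymZeroDiag B → ∃ λ i → Pmat A A′ B ≋ P₂ i
  P₂-complete {A} {A′} {B} inverse symmetric
    with i , Pmat≋P₂ ← P₂-complete-mat₂ _ _ _ _ _ _ _ _ _ _ _ _
                         (IsInverse-resp (mat₂-η A) (mat₂-η A′) inverse) (SymZeroDiag-resp (mat₂-η B) symmetric) =
    i , ≋-trans (Pmat-cong (mat₂-η A) (mat₂-η A′) (mat₂-η B)) Pmat≋P₂

module BinaryLift (F : FiniteField2) where
  open DoubleCosets F
  module 𝔽₂ = BinaryField
  open BinaryField using (P₂; P₂-injective; P₂-closed; P₂-complete; Tr-P₂; GL₂; GL₂⁻¹; SZD₂; GL₂-inverse; SZD₂-SymZeroDiag)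

  ι : Bool → Carrier
  ι false = 0#
  ι true  = 1#

  ι-xor : ∀ a b → ι (a xor b) ≡ ι a + ι b
  ι-xor false b     = sym (+-identityˡ (ι b))
  ι-xor true  false = sym (+-identityʳ 1#)
  ι-xor true  true  = sym 1+1≡0

  ι-∧ : ∀ a b → ι (a ∧ b) ≡ ι a * ι b
  ι-∧ false b = sym (zeroˡ (ι b))
  ι-∧ true  b = sym (*-identityˡ (ι b))

  ι-injective : ∀ {a b} → ι a ≡ ι b → a ≡ b
  ι-injective {false} {false} _ = refl
  ι-injective {false} {true}  e = contradiction e 0≢1
  ι-injective {true}  {false} e = contradiction (sym e) 0≢1
  ι-injective {true}  {true}  _ = refl

  ι-if : ∀ c → ι (if c then true else false) ≡ (if c then 1# else 0#)
  ι-if false = refl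
  ι-if true  = refl

  ι-∑ : ∀ {n} (f : Fin n → Bool) → ι (𝔽₂.∑ f) ≡ ∑ (ι ∘ f)
  ι-∑ {zero}  f = refl
  ι-∑ {suc n} f = trans (ι-xor (f zero) _) (cong (ι (f zero) +_) (ι-∑ (f ∘ suc)))

  lift : ∀ {m n} → 𝔽₂.Mat m n → Mat m n
  lift A i j = ι (A i j)

  lift-cong : ∀ {m n} {A B : 𝔽₂.Mat m n} → A 𝔽₂.≋ B → lift A ≋ lift B
  lift-cong A≋B i j = cong ι (A≋B i j)

  lift-injective : ∀ {m n} {A B : 𝔽₂.Mat m n} → lift A ≋ lift B → A 𝔽₂.≋ B
  lift-injective e i j = ι-injective (e i j)

  lift-⊗ : ∀ {m k n} (A : 𝔽₂.Mat m k) (B : 𝔽₂.Mat k n) → lift (A 𝔽₂.⊗ B) ≋ (lift A ⊗ lift B)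
  lift-⊗ A B i j = trans (ι-∑ (λ l → A i l ∧ B l j)) (∑-cong (λ l → ι-∧ (A i l) (B l j)))

  lift-block : ∀ {n} (A B C D : 𝔽₂.Mat n n) → lift (𝔽₂.block A B C D) ≋ block (lift A) (lift B) (lift C) (lift D)
  lift-block {n} A B C D x y with splitAt n x | splitAt n y
  ... | inj₁ _ | inj₁ _ = refl
  ... | inj₁ _ | inj₂ _ = refl
  ... | inj₂ _ | inj₁ _ = refl
  ... | inj₂ _ | inj₂ _ = refl

  lift-I : ∀ n → lift (𝔽₂.I n) ≋ I n
  lift-I n i j = ι-if ⌊ i Fin.≟ j ⌋

  lift-Pmat : ∀ {n} (A A′ B : 𝔽₂.Mat n n) → lift (𝔽₂.Pmat A A′ B) ≋ Pmat (lift A) (lift A′) (lift B)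
  lift-Pmat {n} A A′ B = ≋-trans (lift-⊗ (𝔽₂.block A (𝔽₂.O n n) (𝔽₂.O n n) (𝔽₂.transpose A′)) (𝔽₂.block (𝔽₂.I n) B (𝔽₂.O n n) (𝔽₂.I n)))
    (⊗-cong (lift-block A (𝔽₂.O n n) (𝔽₂.O n n) (𝔽₂.transpose A′))
            (≋-trans (lift-block (𝔽₂.I n) B (𝔽₂.O n n) (𝔽₂.I n)) (block-cong (lift-I n) ≋-refl ≋-refl (lift-I n))))

  lift-Tr : ∀ {n} (A : 𝔽₂.Mat n n) → ι (𝔽₂.Tr A) ≡ Tr (lift A)
  lift-Tr A = ι-∑ (λ i → A i i)

  σ-2-0 : σ 2 0 ≋ I 4
  σ-2-0 = ≋-trans (σ-0 2) (block-identity {2})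

  1ᴾ : Mat 4 4
  1ᴾ = Pmat (I 2) (I 2) (O 2 2)

  1ᴾ≋I : 1ᴾ ≋ I 4
  1ᴾ≋I = ≋-trans (Pmat-identity {2}) (block-identity {2})

  1ᴾ-InP : InP 2 1ᴾ
  1ᴾ-InP = Pmat-InP (⊗-identityˡ (I 2) , ⊗-identityˡ (I 2)) ((λ _ _ → refl) , (λ _ → refl))

  P : Fin 12 → Mat 4 4
  P = lift ∘ P₂

  P-InP : ∀ i → InP 2 (P i)
  P-InP i = InP-resp (≋-sym (lift-Pmat (GL₂ a) (GL₂⁻¹ a) (SZD₂ b))) (Pmat-InP
    (≋-trans (≋-sym (lift-⊗ (GL₂ a) (GL₂⁻¹ a))) (≋-trans (lift-cong (proj₁ (GL₂-inverse a))) (lift-I 2)) ,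
     ≋-trans (≋-sym (lift-⊗ (GL₂⁻¹ a) (GL₂ a))) (≋-trans (lift-cong (proj₂ (GL₂-inverse a))) (lift-I 2)))
    ((λ x y → cong ι (proj₁ (SZD₂-SymZeroDiag b) x y)) , (λ x → cong ι (proj₂ (SZD₂-SymZeroDiag b) x))))
    where a = proj₁ (Fin.remQuot {6} 2 i)
          b = proj₂ (Fin.remQuot {6} 2 i)

  P-injective : ∀ i j → P i ≋ P j → i ≡ j
  P-injective i j e = P₂-injective i j (lift-injective e)

  Tr-P : ∀ i → Tr (P i) ≡ 0#
  Tr-P i = trans (sym (lift-Tr (P₂ i))) (cong ι (Tr-P₂ i))

  P-closed : ∀ i j → ∃ λ k → (P i ⊗ P j) ≋ P k
  P-closed i j with k , P₂ᵢP₂ⱼ≋P₂ₖ ← P₂-closed i j = k , ≋-trans (≋-sym (lift-⊗ (P₂ i) (P₂ j))) (lift-cong P₂ᵢP₂ⱼ≋P₂ₖ)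

  P-InDC : ∀ i → InDC 2 0 (P i)
  P-InDC i = P i , 1ᴾ , P-InP i , 1ᴾ-InP ,
    ≋-sym (≋-trans (⊗-cong (⊗-cong (≋-refl {A = P i}) σ-2-0) 1ᴾ≋I) (≋-trans (⊗-identityʳ _) (⊗-identityʳ (P i))))

  module _ (r≡1 : r ≡ 1) where
    private
      ≢0⇒≡1 : ∀ {x} → x ≢ 0# → x ≡ 1#
      ≢0⇒≡1 {x} x≢0 = trans (sym (element-index x)) (trans (cong element index-x≡index-1) (element-index 1#))
        where
          index≢ : ∀ {x y} → x ≢ y → index x ≢ index y
          index≢ {x} {y} x≢y e = x≢y (trans (sym (element-index x)) (trans (cong element e) (element-index y)))
          Fin2-third : ∀ {n} → n ≡ 2 → {i j k : Fin n} → i ≢ j → k ≢ j → i ≡ k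
          Fin2-third refl {zero}     {zero}     i≢j _   = contradiction refl i≢j
          Fin2-third refl {zero}     {suc zero} {zero}     _ _ = refl
          Fin2-third refl {zero}     {suc zero} {suc zero} _ k≢j = contradiction refl k≢j
          Fin2-third refl {suc zero} {zero}     {zero}     _ k≢j = contradiction refl k≢j
          Fin2-third refl {suc zero} {zero}     {suc zero} _ _ = refl
          Fin2-third refl {suc zero} {suc zero} i≢j _   = contradiction refl i≢j
          index-x≡index-1 : index x ≡ index 1#
          index-x≡index-1 = Fin2-third (cong (2 ^_) r≡1) (index≢ x≢0) (index≢ (0≢1 ∘ sym))

      bit : Carrier → Bool
      bit x = not ⌊ x ≟ 0# ⌋

      ι-bit : ∀ x → ι (bit x) ≡ x
      ι-bit x with x ≟ 0#
      ... | yes x≡0 = sym x≡0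
      ... | no  x≢0 = sym (≢0⇒≡1 x≢0)

      lower : ∀ {n} → Mat n n → 𝔽₂.Mat n n
      lower A i j = bit (A i j)

      lift-lower : ∀ {n} (A : Mat n n) → A ≋ lift (lower A)
      lift-lower A i j = sym (ι-bit (A i j))

      lower-inverse : ∀ {n} {X Y : Mat n n} → (X ⊗ Y) ≋ I n → (lower X 𝔽₂.⊗ lower Y) 𝔽₂.≋ 𝔽₂.I n
      lower-inverse {n} {X} {Y} XY≋I = lift-injective (≋-trans (lift-⊗ (lower X) (lower Y))
        (≋-trans (⊗-cong (≋-sym (lift-lower X)) (≋-sym (lift-lower Y))) (≋-trans XY≋I (≋-sym (lift-I n)))))

      lower-SymZeroDiag : ∀ {n} {B : Mat n n} → SymZeroDiag B → 𝔽₂.SymZeroDiag (lower B)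
      lower-SymZeroDiag {B = B} (symmetric , zero-diagonal) =
        (λ i j → ι-injective (trans (sym (lift-lower B i j)) (trans (symmetric i j) (lift-lower B j i)))) ,
        (λ i → ι-injective (trans (sym (lift-lower B i i)) (zero-diagonal i)))

    InP⇒P : ∀ {w} → InP 2 w → ∃ λ i → w ≋ P i
    InP⇒P {w} (A , A′ , B , (right , left) , symmetric , w≋)
      with i , Pmat≋P₂ ← P₂-complete (lower-inverse {X = A} {A′} right , lower-inverse {X = A′} {A} left) (lower-SymZeroDiag symmetric) =
      i , ≋-trans w≋ (≋-trans (Pmat-cong (lift-lower A) (lift-lower A′) (lift-lower B))
                              (≋-trans (≋-sym (lift-Pmat (lower A) (lower A′) (lower B))) (lift-cong Pmat≋P₂)))

    -- σ₀ = 1 and P⁺ is closed under products, so the double coset P⁺ σ₀ P⁺ is P⁺ itself.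
    InDC⇒P : ∀ {w} → InDC 2 0 w → ∃ λ k → w ≋ P k
    InDC⇒P {w} (p₁ , p₂ , p₁∈P , p₂∈P , w≋) =
      let i , p₁≋Pᵢ = InP⇒P p₁∈P
          j , p₂≋Pⱼ = InP⇒P p₂∈P
          k , PᵢPⱼ≋Pₖ = P-closed i j
      in k , ≋-trans w≋ (≋-trans (⊗-cong (≋-trans (⊗-cong p₁≋Pᵢ σ-2-0) (⊗-identityʳ (P i))) p₂≋Pⱼ) PᵢPⱼ≋Pₖ)

    |P⁺| : HasCard 12 (InP 2)
    |P⁺| = P , P-InP , P-injective , λ w → InP⇒P

    N-DC≡-2-0-0 : N-DC≡ 2 0 0# 12
    N-DC≡-2-0-0 = P , (λ i → P-InDC i , Tr-P i) , P-injective , λ w (w∈DC , _) → InDC⇒P w∈DC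

    N-DC≡-2-0-1 : N-DC≡ 2 0 1# 0
    N-DC≡-2-0-1 = (λ ()) , (λ ()) , (λ ()) , λ w (w∈DC , Tr≡1) →
      let k , w≋Pₖ = InDC⇒P w∈DC in contradiction (trans (sym (Tr-P k)) (trans (sym (Tr-cong w≋Pₖ)) Tr≡1)) 0≢1

corollary10 : (F : FiniteField2) → let open FieldDefs F in
    -- (a)
    (∀ n → 2 ≤ n → n % 2 ≡ 0 → ∀ β → N-DC>0 n (n ∸ 1) β)
    -- (b)
    × (∀ n → 4 ≤ n → n % 2 ≡ 0 → ∀ β → N-DC>0 n (n ∸ 2) β)
    × (2 ≤ r → ∀ β → N-DC>0 2 0 β)
    × (r ≡ 1 → N-DC≡ 2 0 1# 0 × N-DC≡ 2 0 0# 12 × HasCard 12 (InP 2))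
    -- (c)
    × (∀ n → 3 ≤ n → n % 2 ≡ 1 → ∀ β → N-DC>0 n (n ∸ 1) β)
    × N-DC≡ 1 0 0# 1
    × (∀ β → β ≢ 0# → tr (inv β) ≡ 0# → N-DC≡ 1 0 β 2)
    × (∀ β → β ≢ 0# → tr (inv β) ≡ 1# → N-DC≡ 1 0 β 0)
    -- (d)
    × (∀ n → 3 ≤ n → n % 2 ≡ 1 → ∀ β → N-DC>0 n (n ∸ 2) β)
corollary10 F =
    (λ { (suc (suc m)) _ _ → N-DC>0-large m m ; zero () ; (suc zero) (s≤s ()) }) ,
    (λ { (suc (suc (suc (suc m)))) _ _ → N-DC>0-large (suc (suc m)) (suc m)
       ; zero () ; (suc zero) (s≤s ()) ; (suc (suc zero)) (s≤s (s≤s ())) ; (suc (suc (suc zero))) (s≤s (s≤s (s≤s ()))) }) ,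
    N-DC>0-2-0 ,
    (λ r≡1 → N-DC≡-2-0-1 r≡1 , N-DC≡-2-0-0 r≡1 , |P⁺| r≡1) ,
    (λ { (suc (suc (suc m))) _ _ → N-DC>0-large (suc m) (suc m)
       ; zero () ; (suc zero) (s≤s ()) ; (suc (suc zero)) (s≤s (s≤s ())) }) ,
    N-DC≡-1-0-0 ,
    (λ β β≢0 → N-DC≡-1-0-tr0 β≢0) ,
    (λ β β≢0 → N-DC≡-1-0-tr1 β≢0) ,
    (λ { (suc (suc (suc m))) _ _ → N-DC>0-large (suc m) m
       ; zero () ; (suc zero) (s≤s ()) ; (suc (suc zero)) (s≤s (s≤s ())) })
  where
    open LargeDoubleCosets F using (N-DC>0-large)
    open SmallDoubleCoset F using (N-DC>0-2-0)
    open DimensionOne F using (N-DC≡-1-0-0; N-DC≡-1-0-tr0; N-DC≡-1-0-tr1)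
    open BinaryLift F using (N-DC≡-2-0-0; N-DC≡-2-0-1; |P⁺|)
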